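{- Let $\lambda\vdash n$ and let $T$ be a Richardson tableau of shape $\lambda$. Let $m$ be the largest integer such that the entries $1,2,\ldots,m$ all appear in the first column of $T$. Then the first $m$ evacuation slides in the computation of $\operatorname{evac}(T)$ terminate in rows $r_1,\ldots,r_m$ with $r_1>r_2>\cdots>r_m=1$. Consequently, the entries $n-m+1,\ldots,n$ occupy a column strip in $\operatorname{evac}(T)$, with $n-m+1$ appearing at the end of the first row.
   Context: Young diagrams are in English notation (rows numbered top to bottom). A standard Young tableau (SYT) of shape $\lambda\vdash n$ is a bijective filling of the diagram with $[n]$ increasing along rows and down columns. A column strip is a skew shape with no two boxes in the same row. Evacuation: given an SYT $T$ with $n$ boxes, delete the entry in the top-left cell, decrement all remaining entries by $1$, and perform a jeu-de-taquin slide into the empty cell (repeatedly, the empty cell swaps with the smaller of its right and lower neighbours among non-frozen cells, until no such neighbour exists), obtaining an SYT on $n-1$ boxes whose shape is $\lambda$ minus a corner cell $c$; place $n$ in $c$ and freeze it. Repeat on the non-frozen part (placing $n-1$, then $n-2$, etc.) until all boxes are frozen; the result is $\operatorname{evac}(T)$. The $i$-th evacuation slide terminates in row $r$ if the cell in which $n+1-i$ is frozen lies in row $r$. For an SYT $T$ of shape $\lambda$, $\operatorname{crop}(T)$ is the SYT of shape $(\lambda_2,\lambda_3,\ldots)$ obtained by deleting the first row of $T$ and standardizing the remaining entries to $1,\ldots,|\lambda|-\lambda_1$ (preserving relative order). An SYT $T$ is a Richardson tableau if (1) for every entry $j$ in the second row of $T$, the entry $j-1$ lies in the first row, and (2) $\operatorname{crop}(T)$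 is a Richardson tableau (the empty tableau being Richardson). -}

module Defs where

open import Data.Nat using (ℕ; zero; suc; pred; _+_; _∸_; _≤_; _<_; _<ᵇ_; _≤ᵇ_)
open import Data.Bool using (Bool; true; false; if_then_else_)
open import Data.List using (List; []; _∷_; length; map; concat; upTo)
open import Data.Nat.ListAction using (sum)
open import Data.Maybe using (Maybe; just; nothing)
open import Data.Product using (_×_; _,_; ∃; proj₁; proj₂)
open import Relation.Binary.PropositionalEquality using (_≡_)
open import Data.List.Relation.Binary.Permutation.Propositional using (_↭_)

-- Tableaux in English notation: a list of rows, top row first.
-- Coordinates (i , j) are 0-based internally: row i (paper's row i+1),
-- column j (paper's column j+1).

Tableau : Set
Tableau = List (List ℕ)

nth : {A : Set} → List A → ℕ → Maybe A
nth []       _       = nothing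
nth (x ∷ xs) zero    = just x
nth (x ∷ xs) (suc k) = nth xs k

lastElem : {A : Set} → List A → Maybe A
lastElem []           = nothing
lastElem (x ∷ [])     = just x
lastElem (x ∷ y ∷ xs) = lastElem (y ∷ xs)

entry : Tableau → ℕ → ℕ → Maybe ℕ
entry T i j with nth T i
... | nothing  = nothing
... | just row = nth row j

modify : {A : Set} → ℕ → (A → A) → List A → List A
modify _       f []       = []
modify zero    f (x ∷ xs) = f x ∷ xs
modify (suc k) f (x ∷ xs) = x ∷ modify k f xs

setEntry : Tableau → ℕ → ℕ → ℕ → Tableau
setEntry T i j v = modify i (modify j (λ _ → v)) T

dropLast : {A : Set} → List A → List A
dropLast []           = []
dropLast (x ∷ [])     = []
dropLast (x ∷ y ∷ xs) = x ∷ dropLast (y ∷ xs)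

dropEmptyRows : Tableau → Tableau
dropEmptyRows []             = []
dropEmptyRows ([] ∷ rs)      = dropEmptyRows rs
dropEmptyRows ((x ∷ r) ∷ rs) = (x ∷ r) ∷ dropEmptyRows rs

removeCell : Tableau → ℕ → Tableau
removeCell T i = dropEmptyRows (modify i dropLast T)

size : Tableau → ℕ
size T = sum (map length T)

record IsSYT (n : ℕ) (T : Tableau) : Set where
  field
    rowsNonEmpty : ∀ i r → nth T i ≡ just r → 0 < length r
    shapeDecr    : ∀ i r r' → nth T i ≡ just r → nth T (suc i) ≡ just r' →
                   length r' ≤ length r
    entriesPerm  : concat T ↭ map suc (upTo n)
    rowIncr      : ∀ i j a b → entry T i j ≡ just a → entry T i (suc j) ≡ just b → a < b
    colIncr      : ∀ i j b → entry T (suc i) j ≡ just b →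
                   ∃ λ a → entry T i j ≡ just a × a < b

-- The hole at (i , j) holds the dummy value 0.
-- Fuel bounds the length of the path (the number of cells suffices).

slide : ℕ → Tableau → ℕ → ℕ → Tableau × (ℕ × ℕ)
slide zero    T i j = removeCell T i , (i , j)
slide (suc k) T i j = step (entry T i (suc j)) (entry T (suc i) j)
  where
  moveRight : ℕ → Tableau × (ℕ × ℕ)
  moveRight r = slide k (setEntry (setEntry T i j r) i (suc j) 0) i (suc j)
  moveDown : ℕ → Tableau × (ℕ × ℕ)
  moveDown b = slide k (setEntry (setEntry T i j b) (suc i) j 0) (suc i) j
  step : Maybe ℕ → Maybe ℕ → Tableau × (ℕ × ℕ)
  step nothing  nothing  = removeCell T i , (i , j)
  step (just r) nothing  = moveRight r
  step nothing  (just b) = moveDown b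
  step (just r) (just b) = if r <ᵇ b then moveRight r else moveDown b

-- One evacuation step on the non-frozen part: delete the top-left entry,
-- slide into the empty cell, decrement all entries.  Returns the new
-- non-frozen tableau and the vacated corner cell (where the next frozen
-- value is placed).
promote : Tableau → Tableau × (ℕ × ℕ)
promote T with slide (size T) (setEntry T 0 0 0) 0 0
... | (T' , c) = map (map pred) T' , c

-- The cells in which the successive slides terminate (k-th element =
-- the cell where size T + 1 - k is frozen).
evacCornersAux : ℕ → Tableau → List (ℕ × ℕ)
evacCornersAux zero    T = []
evacCornersAux (suc k) T = proj₂ (promote T) ∷ evacCornersAux k (proj₁ (promote T))

evacCorners : Tableau → List (ℕ × ℕ)
evacCorners T = evacCornersAux (size T) T

place : List (ℕ × ℕ) → ℕ → Tableau → Tableau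
place []             v C = C
place ((i , j) ∷ ps) v C = place ps (pred v) (setEntry C i j v)

-- evac(T): on the canvas of shape λ, put n, n-1, ... into the frozen cells.
evac : Tableau → Tableau
evac T = place (evacCorners T) (size T) T

-- the row (1-based, as in the paper) in which the k-th evacuation slide
-- (k ≥ 1) terminates
termRow : Tableau → ℕ → Maybe ℕ
termRow T k with nth (evacCorners T) (pred k)
... | nothing      = nothing
... | just (i , _) = just (suc i)

countLeq : ℕ → List ℕ → ℕ
countLeq x []       = 0
countLeq x (y ∷ ys) = if y ≤ᵇ x then suc (countLeq x ys) else countLeq x ys

standardize : Tableau → Tableau
standardize T = map (map (λ x → countLeq x (concat T))) T

crop : Tableau → Tableau
crop []       = []
crop (r ∷ rs) = standardize rs

SecondRowCond : Tableau → Set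
SecondRowCond T = ∀ c j → entry T 1 c ≡ just j → ∃ λ c' → entry T 0 c' ≡ just (j ∸ 1)

data Richardson : Tableau → Set where
  rich-[] : Richardson []
  rich-∷  : ∀ {r rs} → SecondRowCond (r ∷ rs) → Richardson (crop (r ∷ rs)) →
            Richardson (r ∷ rs)

FirstColumnHas : Tableau → ℕ → Set
FirstColumnHas T m = ∀ k → 1 ≤ k → k ≤ m → ∃ λ i → entry T i 0 ≡ just k

NoTwoInSameRow : Tableau → ℕ → ℕ → Set
NoTwoInSameRow E lo hi = ∀ a b i j i' j' → lo ≤ a → a ≤ hi → lo ≤ b → b ≤ hi →
  entry E i j ≡ just a → entry E i' j' ≡ just b → i ≡ i' → a ≡ b

-- Call a tableau admissible if it is standard up to the values and interlaced:
-- whenever x lies in row i + 1 and z < x lies in row i + 1 or below, some w in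
-- row i satisfies z ≤ w < x.  Richardson tableaux are admissible (on the top two
-- rows this is the Richardson condition, below it follows from crop), and
-- promotion (delete the top-left entry, slide, decrement) preserves admissibility.
-- In an admissible tableau the evacuation slide is an L: the hole goes down the
-- first column to some row a and then right to the end of row a, since
-- interlacing forbids a second downward step.  If 1, …, m fill the top of the
-- first column, the first slide leaves the column in row m − 1 or lower, every
-- later one of the first m slides exits strictly higher than its predecessor,
-- and the m-th slide runs along the first row to its end.  So n, …, n − m + 1
-- are frozen in distinct rows, the last one at the end of the first row.

module Submission where

open import Defs
open import Data.Nat using (ℕ; zero; suc; pred; _+_; _∸_; _≤_; _<_; _<ᵇ_; _≤ᵇ_; z≤n; s≤s; _≤?_; _<?_; _≟_; >-nonZero; z<s)
open import Data.Nat.Properties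
open import Data.Bool using (true; false)
import Data.Bool as Bool
open import Data.List using (List; []; _∷_; length; map; concat; upTo; _++_)
open import Data.List.Properties using (length-map; length-++; length-applyUpTo)
open import Data.List.Membership.Propositional using (_∈_)
open import Data.List.Membership.Propositional.Properties using (∈-++⁺ˡ; ∈-++⁺ʳ; ∈-++⁻; ∈-map⁺; ∈-map⁻; ∈-upTo⁺; ∈-upTo⁻)
open import Data.List.Relation.Unary.Any using (here; there)
import Data.List.Relation.Unary.All as All
import Data.List.Relation.Unary.All.Properties as All
open import Data.List.Relation.Unary.AllPairs using ([]; _∷_)
open import Data.List.Relation.Unary.Unique.Propositional using (Unique)
import Data.List.Relation.Unary.Unique.Propositional.Properties as Unique
open import Data.List.Relation.Binary.Permutation.Propositional using (↭-sym; ↭⇒↭ₛ)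
open import Data.List.Relation.Binary.Permutation.Propositional.Properties using (∈-resp-↭; ↭-length)
open import Data.Maybe using (Maybe; just; nothing)
import Data.Maybe as Maybe
open import Data.Maybe.Properties using (just-injective)
open import Data.Product using (_×_; _,_; ∃; ∃₂; proj₁; proj₂)
open import Data.Sum using (_⊎_; inj₁; inj₂)
open import Data.Empty using (⊥; ⊥-elim)
open import Function using (_∘′_)
open import Data.Unit using (⊤; tt)
open import Relation.Nullary using (¬_; Dec; yes; no)
open import Relation.Binary.Definitions using (tri<; tri≈; tri>)
open import Relation.Binary.PropositionalEquality
open import Data.List.Relation.Binary.Permutation.Setoid.Properties (setoid ℕ) using (Unique-resp-↭)

-- Structural recursion on the rows, unlike `entry`, which goes through `nth`.
entry′ : Tableau → ℕ → ℕ → Maybe ℕ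
entry′ []       i       j = nothing
entry′ (r ∷ rs) zero    j = nth r j
entry′ (r ∷ rs) (suc i) j = entry′ rs i j

entry≡entry′ : ∀ T i j → entry T i j ≡ entry′ T i j
entry≡entry′ []      i       j = refl
entry≡entry′ (r ∷ T) zero    j = refl
entry≡entry′ (r ∷ T) (suc i) j with nth T i | entry≡entry′ T i j
... | nothing | e = e
... | just _  | e = e

Defined : {A : Set} → Maybe A → Set
Defined m = ∃ λ x → m ≡ just x

just≢nothing : ∀ {x : ℕ} → just x ≢ nothing
just≢nothing ()

RowsNonEmpty : Tableau → Set
RowsNonEmpty []       = ⊤
RowsNonEmpty (r ∷ rs) = 0 < length r × RowsNonEmpty rs

nth-defined-pred : ∀ {A : Set} (r : List A) j → Defined (nth r (suc j)) → Defined (nth r j)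
nth-defined-pred []      j       (_ , ())
nth-defined-pred (y ∷ r) zero    d = y , refl
nth-defined-pred (y ∷ r) (suc j) d = nth-defined-pred r j d

defined-left : ∀ T i j → Defined (entry′ T i (suc j)) → Defined (entry′ T i j)
defined-left []      i       j (_ , ())
defined-left (r ∷ T) zero    j d = nth-defined-pred r j d
defined-left (r ∷ T) (suc i) j d = defined-left T i j d

defined-left* : ∀ T i j k → j ≤ k → Defined (entry′ T i k) → Defined (entry′ T i j)
defined-left* T i j zero    z≤n d = d
defined-left* T i j (suc k) le d with m≤n⇒m<n∨m≡n le
... | inj₂ refl       = d
... | inj₁ (s≤s j≤k) = defined-left* T i j k j≤k (defined-left T i k d)

beyond-row-end : ∀ T i p q → entry′ T i (suc p) ≡ nothing → p < q → entry′ T i q ≡ nothing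
beyond-row-end T i p q end p<q with entry′ T i q in e
... | nothing = refl
... | just x  = ⊥-elim (just≢nothing (trans (sym (proj₂ (defined-left* T i (suc p) q p<q (x , e)))) end))

nth-defined⇒<length : ∀ {A : Set} (r : List A) j → Defined (nth r j) → j < length r
nth-defined⇒<length []      j       (_ , ())
nth-defined⇒<length (y ∷ r) zero    d = s≤s z≤n
nth-defined⇒<length (y ∷ r) (suc j) d = s≤s (nth-defined⇒<length r j d)

<length⇒nth-defined : ∀ {A : Set} (r : List A) j → j < length r → Defined (nth r j)
<length⇒nth-defined (y ∷ r) zero    p       = y , refl
<length⇒nth-defined (y ∷ r) (suc j) (s≤s p) = <length⇒nth-defined r j p

length≤⇒nth≡nothing : ∀ {A : Set} (r : List A) j → length r ≤ j → nth r j ≡ nothing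
length≤⇒nth≡nothing []      j       p       = refl
length≤⇒nth≡nothing (y ∷ r) (suc j) (s≤s p) = length≤⇒nth≡nothing r j p

entry′⇒row : ∀ T i j x → entry′ T i j ≡ just x → ∃ λ r → nth T i ≡ just r × nth r j ≡ just x
entry′⇒row (r ∷ T) zero    j x e = r , refl , e
entry′⇒row (r ∷ T) (suc i) j x e = entry′⇒row T i j x e

entry′-row : ∀ T i r j → nth T i ≡ just r → entry′ T i j ≡ nth r j
entry′-row (r ∷ T)  zero    .r j refl = refl
entry′-row (r′ ∷ T) (suc i) r  j e    = entry′-row T i r j e

row-absent : ∀ T i → RowsNonEmpty T → entry′ T i 0 ≡ nothing → nth T i ≡ nothing
row-absent []            i       ne       e = refl
row-absent ((y ∷ r) ∷ T) zero    ne       ()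
row-absent (r ∷ T)       (suc i) (_ , ne) e = row-absent T i ne e

last-cell⇒row-length : ∀ T i p x → entry′ T i p ≡ just x → entry′ T i (suc p) ≡ nothing →
                       ∃ λ r → nth T i ≡ just r × length r ≡ suc p
last-cell⇒row-length T i p x e₁ e₂ with entry′⇒row T i p x e₁
... | r , nr , np = r , nr , ≤-antisym (≮⇒≥ beyond) (nth-defined⇒<length r p (x , np))
  where
  beyond : ¬ suc p < length r
  beyond lt with <length⇒nth-defined r (suc p) lt
  ... | _ , e = just≢nothing (trans (sym e) (trans (sym (entry′-row T i r (suc p) nr)) e₂))

RowEndsAt : Tableau → ℕ → ℕ → Set
RowEndsAt T i p = Defined (entry′ T i p) × entry′ T i (suc p) ≡ nothing

row-end : ∀ T i x → entry′ T i 0 ≡ just x → ∃ (RowEndsAt T i)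
row-end T i x e with entry′⇒row T i 0 x e
... | r , nr , n₀ = pred (length r) , end , after
  where
  last : suc (pred (length r)) ≡ length r
  last = suc-pred (length r) {{>-nonZero (nth-defined⇒<length r 0 (x , n₀))}}
  end : Defined (entry′ T i (pred (length r)))
  end = subst Defined (sym (entry′-row T i r _ nr)) (<length⇒nth-defined r _ (≤-reflexive last))
  after : entry′ T i (suc (pred (length r))) ≡ nothing
  after = trans (entry′-row T i r _ nr) (length≤⇒nth≡nothing r _ (≤-reflexive (sym last)))

cell-bound : ∀ T i j → RowsNonEmpty T → Defined (entry′ T i j) → i + j < size T
cell-bound (r ∷ T) zero    j _        d = ≤-trans (nth-defined⇒<length r j d) (m≤m+n (length r) (size T))
cell-bound (r ∷ T) (suc i) j (p , ne) d = ≤-trans (s≤s (cell-bound T i j ne d)) (+-monoˡ-≤ (size T) p)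

nth-modify-same : ∀ {A : Set} k (f : A → A) xs → nth (modify k f xs) k ≡ Maybe.map f (nth xs k)
nth-modify-same k       f []       = refl
nth-modify-same zero    f (x ∷ xs) = refl
nth-modify-same (suc k) f (x ∷ xs) = nth-modify-same k f xs

nth-modify-other : ∀ {A : Set} k k′ (f : A → A) xs → k′ ≢ k → nth (modify k f xs) k′ ≡ nth xs k′
nth-modify-other k       k′       f []       ne = refl
nth-modify-other zero    zero     f (x ∷ xs) ne = ⊥-elim (ne refl)
nth-modify-other zero    (suc k′) f (x ∷ xs) ne = refl
nth-modify-other (suc k) zero     f (x ∷ xs) ne = refl
nth-modify-other (suc k) (suc k′) f (x ∷ xs) ne = nth-modify-other k k′ f xs (ne ∘′ cong suc)

length-modify : ∀ {A : Set} k (f : A → A) xs → length (modify k f xs) ≡ length xs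
length-modify k       f []       = refl
length-modify zero    f (x ∷ xs) = refl
length-modify (suc k) f (x ∷ xs) = cong suc (length-modify k f xs)

entry′-setEntry-same : ∀ T i j v → entry′ (setEntry T i j v) i j ≡ Maybe.map (λ _ → v) (entry′ T i j)
entry′-setEntry-same []      i       j v = refl
entry′-setEntry-same (r ∷ T) zero    j v = nth-modify-same j (λ _ → v) r
entry′-setEntry-same (r ∷ T) (suc i) j v = entry′-setEntry-same T i j v

entry′-setEntry-other : ∀ T i j v i′ j′ → i′ ≢ i ⊎ j′ ≢ j → entry′ (setEntry T i j v) i′ j′ ≡ entry′ T i′ j′
entry′-setEntry-other []      i       j v i′       j′ ne        = refl
entry′-setEntry-other (r ∷ T) zero    j v zero     j′ (inj₁ ne) = ⊥-elim (ne refl)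
entry′-setEntry-other (r ∷ T) zero    j v zero     j′ (inj₂ ne) = nth-modify-other j j′ (λ _ → v) r ne
entry′-setEntry-other (r ∷ T) zero    j v (suc i′) j′ ne        = refl
entry′-setEntry-other (r ∷ T) (suc i) j v zero     j′ ne        = refl
entry′-setEntry-other (r ∷ T) (suc i) j v (suc i′) j′ (inj₁ ne) =
  entry′-setEntry-other T i j v i′ j′ (inj₁ (λ e → ne (cong suc e)))
entry′-setEntry-other (r ∷ T) (suc i) j v (suc i′) j′ (inj₂ ne) =
  entry′-setEntry-other T i j v i′ j′ (inj₂ ne)

entry′-setEntry-defined : ∀ T i j v x → entry′ T i j ≡ just x → entry′ (setEntry T i j v) i j ≡ just v
entry′-setEntry-defined T i j v x e rewrite entry′-setEntry-same T i j v | e = refl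

rowsNonEmpty-setEntry : ∀ T i j v → RowsNonEmpty T → RowsNonEmpty (setEntry T i j v)
rowsNonEmpty-setEntry []      i       j v ne       = tt
rowsNonEmpty-setEntry (r ∷ T) zero    j v (p , ne) = subst (0 <_) (sym (length-modify j (λ _ → v) r)) p , ne
rowsNonEmpty-setEntry (r ∷ T) (suc i) j v (p , ne) = p , rowsNonEmpty-setEntry T i j v ne

size-setEntry : ∀ T i j v → size (setEntry T i j v) ≡ size T
size-setEntry []      i       j v = refl
size-setEntry (r ∷ T) zero    j v = cong (_+ size T) (length-modify j (λ _ → v) r)
size-setEntry (r ∷ T) (suc i) j v = cong (length r +_) (size-setEntry T i j v)

nth-map : ∀ {A B : Set} (f : A → B) xs k → nth (map f xs) k ≡ Maybe.map f (nth xs k)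
nth-map f []       k       = refl
nth-map f (x ∷ xs) zero    = refl
nth-map f (x ∷ xs) (suc k) = nth-map f xs k

entry′-map : ∀ f T i j → entry′ (map (map f) T) i j ≡ Maybe.map f (entry′ T i j)
entry′-map f []      i       j = refl
entry′-map f (r ∷ T) zero    j = nth-map f r j
entry′-map f (r ∷ T) (suc i) j = entry′-map f T i j

size-map : ∀ f T → size (map (map f) T) ≡ size T
size-map f []      = refl
size-map f (r ∷ T) = cong₂ _+_ (length-map f r) (size-map f T)

rowsNonEmpty-map : ∀ f T → RowsNonEmpty T → RowsNonEmpty (map (map f) T)
rowsNonEmpty-map f []      ne       = tt
rowsNonEmpty-map f (r ∷ T) (p , ne) = subst (0 <_) (sym (length-map f r)) p , rowsNonEmpty-map f T ne

rowsNonEmpty-dropEmptyRows : ∀ T → RowsNonEmpty (dropEmptyRows T)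
rowsNonEmpty-dropEmptyRows []            = tt
rowsNonEmpty-dropEmptyRows ([] ∷ T)      = rowsNonEmpty-dropEmptyRows T
rowsNonEmpty-dropEmptyRows ((x ∷ r) ∷ T) = s≤s z≤n , rowsNonEmpty-dropEmptyRows T

rowsNonEmpty-removeCell : ∀ T i → RowsNonEmpty (removeCell T i)
rowsNonEmpty-removeCell T i = rowsNonEmpty-dropEmptyRows (modify i dropLast T)

dropEmptyRows-id : ∀ T → RowsNonEmpty T → dropEmptyRows T ≡ T
dropEmptyRows-id []            ne       = refl
dropEmptyRows-id ((x ∷ r) ∷ T) (_ , ne) = cong ((x ∷ r) ∷_) (dropEmptyRows-id T ne)

size-dropEmptyRows : ∀ T → size (dropEmptyRows T) ≡ size T
size-dropEmptyRows []            = refl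
size-dropEmptyRows ([] ∷ T)      = size-dropEmptyRows T
size-dropEmptyRows ((x ∷ r) ∷ T) = cong (suc (length r) +_) (size-dropEmptyRows T)

length-dropLast : ∀ (r : List ℕ) → length (dropLast r) ≡ pred (length r)
length-dropLast []          = refl
length-dropLast (x ∷ [])    = refl
length-dropLast (x ∷ y ∷ r) = cong suc (length-dropLast (y ∷ r))

size-modify-dropLast : ∀ T i r → nth T i ≡ just r → 0 < length r → suc (size (modify i dropLast T)) ≡ size T
size-modify-dropLast (r ∷ T) zero .r refl p with r | length-dropLast r
... | x ∷ r′ | e = cong (λ l → suc l + size T) e
size-modify-dropLast (r′ ∷ T) (suc i) r e p =
  trans (sym (+-suc (length r′) _)) (cong (length r′ +_) (size-modify-dropLast T i r e p))

size-removeCell : ∀ T i r → nth T i ≡ just r → 0 < length r → suc (size (removeCell T i)) ≡ size T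
size-removeCell T i r e p = trans (cong suc (size-dropEmptyRows (modify i dropLast T))) (size-modify-dropLast T i r e p)

nth-dropLast-other : ∀ (r : List ℕ) j → suc j ≢ length r → nth (dropLast r) j ≡ nth r j
nth-dropLast-other []          j       ne = refl
nth-dropLast-other (x ∷ [])    zero    ne = ⊥-elim (ne refl)
nth-dropLast-other (x ∷ [])    (suc j) ne = refl
nth-dropLast-other (x ∷ y ∷ r) zero    ne = refl
nth-dropLast-other (x ∷ y ∷ r) (suc j) ne = nth-dropLast-other (y ∷ r) j (λ e → ne (cong suc e))

nth-dropLast-last : ∀ (r : List ℕ) → nth (dropLast r) (pred (length r)) ≡ nothing
nth-dropLast-last []          = refl
nth-dropLast-last (x ∷ [])    = refl
nth-dropLast-last (x ∷ y ∷ r) = nth-dropLast-last (y ∷ r)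

-- The hypothesis `length r ≡ 1 → …` says that if row i becomes empty it is the
-- last row, so that `dropEmptyRows` does not shift the rows below it.
entry′-removeCell-other : ∀ T i r → RowsNonEmpty T → nth T i ≡ just r → (length r ≡ 1 → nth T (suc i) ≡ nothing) →
                          ∀ i′ j′ → i′ ≢ i ⊎ suc j′ ≢ length r → entry′ (removeCell T i) i′ j′ ≡ entry′ T i′ j′
entry′-removeCell-other ((x ∷ []) ∷ []) zero _ ne refl last zero zero (inj₁ n) = ⊥-elim (n refl)
entry′-removeCell-other ((x ∷ []) ∷ []) zero _ ne refl last zero zero (inj₂ n) = ⊥-elim (n refl)
entry′-removeCell-other ((x ∷ []) ∷ []) zero _ ne refl last zero (suc j′) d = refl
entry′-removeCell-other ((x ∷ []) ∷ []) zero _ ne refl last (suc i′) j′ d = refl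
entry′-removeCell-other ((x ∷ []) ∷ (r′ ∷ T)) zero _ ne refl last i′ j′ d with last refl
... | ()
entry′-removeCell-other ((x ∷ y ∷ r) ∷ T) zero _ _ refl last zero j′ (inj₁ n) = ⊥-elim (n refl)
entry′-removeCell-other ((x ∷ y ∷ r) ∷ T) zero _ _ refl last zero j′ (inj₂ n) =
  nth-dropLast-other (x ∷ y ∷ r) j′ n
entry′-removeCell-other ((x ∷ y ∷ r) ∷ T) zero _ (_ , ne) refl last (suc i′) j′ d =
  cong (λ U → entry′ U i′ j′) (dropEmptyRows-id T ne)
entry′-removeCell-other ((x ∷ r′) ∷ T) (suc i) r _ e last zero j′ d = refl
entry′-removeCell-other ((x ∷ r′) ∷ T) (suc i) r (_ , ne) e last (suc i′) j′ (inj₁ n) =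
  entry′-removeCell-other T i r ne e last i′ j′ (inj₁ (λ q → n (cong suc q)))
entry′-removeCell-other ((x ∷ r′) ∷ T) (suc i) r (_ , ne) e last (suc i′) j′ (inj₂ n) =
  entry′-removeCell-other T i r ne e last i′ j′ (inj₂ n)

entry′-removeCell-same : ∀ T i r → RowsNonEmpty T → nth T i ≡ just r → (length r ≡ 1 → nth T (suc i) ≡ nothing) →
                         entry′ (removeCell T i) i (pred (length r)) ≡ nothing
entry′-removeCell-same ((x ∷ []) ∷ [])        zero    _ ne       refl last = refl
entry′-removeCell-same ((x ∷ []) ∷ (r′ ∷ T))  zero    _ ne       refl last with last refl
... | ()
entry′-removeCell-same ((x ∷ y ∷ r) ∷ T)      zero    _ ne       refl last = nth-dropLast-last (x ∷ y ∷ r)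
entry′-removeCell-same ((x ∷ r′) ∷ T)         (suc i) r (_ , ne) e    last = entry′-removeCell-same T i r ne e last

-- The property of Richardson tableaux that survives promotion.
Interlacing : Tableau → Set
Interlacing T = ∀ i j x → entry′ T (suc i) j ≡ just x →
                ∀ i₂ j₂ z → suc i ≤ i₂ → entry′ T i₂ j₂ ≡ just z → z < x →
                ∃₂ λ j′ w → entry′ T i j′ ≡ just w × z ≤ w × w < x

record Admissible (T : Tableau) : Set where
  field
    rowsNonEmpty  : RowsNonEmpty T
    defined-up    : ∀ i j → Defined (entry′ T (suc i) j) → Defined (entry′ T i j)
    rowIncreasing : ∀ i j x y → entry′ T i j ≡ just x → entry′ T i (suc j) ≡ just y → x < y
    colIncreasing : ∀ i j x y → entry′ T i j ≡ just x → entry′ T (suc i) j ≡ just y → x < y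
    positive      : ∀ i j x → entry′ T i j ≡ just x → 1 ≤ x
    injective     : ∀ i j i′ j′ x → entry′ T i j ≡ just x → entry′ T i′ j′ ≡ just x → i ≡ i′ × j ≡ j′
    interlacing   : Interlacing T

module AdmissibleProperties {T : Tableau} (A : Admissible T) where
  open Admissible A

  defined-up* : ∀ i k j → i ≤ k → Defined (entry′ T k j) → Defined (entry′ T i j)
  defined-up* i zero    j z≤n d = d
  defined-up* i (suc k) j le d with m≤n⇒m<n∨m≡n le
  ... | inj₂ refl       = d
  ... | inj₁ (s≤s i≤k) = defined-up* i k j i≤k (defined-up k j d)

  row-strict : ∀ i j k x y → j < k → entry′ T i j ≡ just x → entry′ T i k ≡ just y → x < y
  row-strict i j (suc k) x y (s≤s le) ex ey with defined-left T i k (y , ey)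
  ... | y′ , ey′ with m≤n⇒m<n∨m≡n le
  ... | inj₂ refl = rowIncreasing i j x y ex ey
  ... | inj₁ lt   = <-trans (row-strict i j k x y′ lt ex ey′) (rowIncreasing i k y′ y ey′ ey)

  row-mono : ∀ i j k x y → j ≤ k → entry′ T i j ≡ just x → entry′ T i k ≡ just y → x ≤ y
  row-mono i j k x y le ex ey with m≤n⇒m<n∨m≡n le
  ... | inj₁ lt   = <⇒≤ (row-strict i j k x y lt ex ey)
  ... | inj₂ refl = ≤-reflexive (just-injective (trans (sym ex) ey))

  col-strict : ∀ i k j x y → i < k → entry′ T i j ≡ just x → entry′ T k j ≡ just y → x < y
  col-strict i (suc k) j x y (s≤s le) ex ey with defined-up k j (y , ey)
  ... | y′ , ey′ with m≤n⇒m<n∨m≡n le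
  ... | inj₂ refl = colIncreasing i j x y ex ey
  ... | inj₁ lt   = <-trans (col-strict i k j x y′ lt ex ey′) (colIncreasing k j y′ y ey′ ey)

  col-mono : ∀ i k j x y → i ≤ k → entry′ T i j ≡ just x → entry′ T k j ≡ just y → x ≤ y
  col-mono i k j x y le ex ey with m≤n⇒m<n∨m≡n le
  ... | inj₁ lt   = <⇒≤ (col-strict i k j x y lt ex ey)
  ... | inj₂ refl = ≤-reflexive (just-injective (trans (sym ex) ey))

  mono : ∀ i j k l x y → i ≤ k → j ≤ l → entry′ T i j ≡ just x → entry′ T k l ≡ just y → x ≤ y
  mono i j k l x y ik jl ex ey with defined-up* i k l ik (y , ey)
  ... | w , ew = ≤-trans (row-mono i j l x w jl ex ew) (col-mono i k l w y ik ew ey)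

  row-<-reflects : ∀ i j k x y → entry′ T i j ≡ just x → entry′ T i k ≡ just y → x < y → j < k
  row-<-reflects i j k x y ex ey lt with <-cmp j k
  ... | tri< j<k _ _ = j<k
  ... | tri≈ _ refl _ = ⊥-elim (<-irrefl (just-injective (trans (sym ex) ey)) lt)
  ... | tri> _ _ k<j = ⊥-elim (<-asym lt (row-strict i k j y x k<j ey ex))

  off-corner⇒≥2 : ∀ i j x → entry′ T i j ≡ just x → i ≢ 0 ⊎ j ≢ 0 → 2 ≤ x
  off-corner⇒≥2 i (suc j) x e _ with defined-left T i j (x , e)
  ... | y , ey = ≤-trans (s≤s (positive i j y ey)) (rowIncreasing i j y x ey e)
  off-corner⇒≥2 (suc i) zero x e _ with defined-up i 0 (x , e)
  ... | y , ey = ≤-trans (s≤s (positive i 0 y ey)) (colIncreasing i 0 y x ey e)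
  off-corner⇒≥2 zero zero x e (inj₁ n) = ⊥-elim (n refl)
  off-corner⇒≥2 zero zero x e (inj₂ n) = ⊥-elim (n refl)

SlidesDown : Tableau → ℕ → Set
SlidesDown T k = ∃ λ b → entry′ T (suc k) 0 ≡ just b × (∀ r → entry′ T k 1 ≡ just r → b ≤ r)

slidesDown? : ∀ T k → Dec (SlidesDown T k)
slidesDown? T k with entry′ T (suc k) 0 | entry′ T k 1
... | nothing | _       = no λ { (b , () , _) }
... | just b  | nothing = yes (b , refl , λ r ())
... | just b  | just r  with b ≤? r
... | yes b≤r = yes (b , refl , λ r′ e → subst (b ≤_) (just-injective e) b≤r)
... | no  b≰r = no λ { (b′ , e , f) → b≰r (subst (_≤ r) (sym (just-injective e)) (f r refl)) }

entry′-beyond-rows : ∀ T i j → length T ≤ i → entry′ T i j ≡ nothing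
entry′-beyond-rows []      i       j le       = refl
entry′-beyond-rows (r ∷ T) (suc i) j (s≤s le) = entry′-beyond-rows T i j le

exitRow : ∀ T → ∃ λ a → (∀ k → k < a → SlidesDown T k) × ¬ SlidesDown T a
exitRow T = search 0 (length T) (λ k ()) (not-at-bottom (length T + 0) (m≤m+n (length T) 0))
  where
  not-at-bottom : ∀ k → length T ≤ k → ¬ SlidesDown T k
  not-at-bottom k le (b , e , _) = just≢nothing (trans (sym e) (entry′-beyond-rows T (suc k) 0 (m≤n⇒m≤1+n le)))
  search : ∀ k fuel → (∀ k′ → k′ < k → SlidesDown T k′) → ¬ SlidesDown T (fuel + k) →
           ∃ λ a → (∀ k′ → k′ < a → SlidesDown T k′) × ¬ SlidesDown T a
  search k zero       below stop = k , below , stop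
  search k (suc fuel) below stop with slidesDown? T k
  ... | no stop′ = k , below , stop′
  ... | yes down = search (suc k) fuel below′ (subst (¬_ ∘′ SlidesDown T) (sym (+-suc fuel k)) stop)
    where
    below′ : ∀ k′ → k′ < suc k → SlidesDown T k′
    below′ k′ (s≤s le) with m≤n⇒m<n∨m≡n le
    ... | inj₁ lt   = below k′ lt
    ... | inj₂ refl = down

<ᵇ≡false : ∀ r b → b ≤ r → (r <ᵇ b) ≡ false
<ᵇ≡false r b b≤r with r <ᵇ b | <ᵇ⇒< r b
... | false | _ = refl
... | true  | f = ⊥-elim (<⇒≱ (f tt) b≤r)

<ᵇ≡true : ∀ r b → r < b → (r <ᵇ b) ≡ true
<ᵇ≡true r b r<b with r <ᵇ b | <⇒<ᵇ r<b
... | true  | _ = refl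
... | false | ()

module TwoWrites (U : Tableau) (i₁ j₁ v₁ i₂ j₂ v₂ : ℕ) where
  written : Tableau
  written = setEntry (setEntry U i₁ j₁ v₁) i₂ j₂ v₂

  written-second : ∀ y → entry′ U i₂ j₂ ≡ just y → i₂ ≢ i₁ ⊎ j₂ ≢ j₁ → entry′ written i₂ j₂ ≡ just v₂
  written-second y e d =
    entry′-setEntry-defined (setEntry U i₁ j₁ v₁) i₂ j₂ v₂ y (trans (entry′-setEntry-other U i₁ j₁ v₁ i₂ j₂ d) e)

  written-first : ∀ y → entry′ U i₁ j₁ ≡ just y → i₁ ≢ i₂ ⊎ j₁ ≢ j₂ → entry′ written i₁ j₁ ≡ just v₁
  written-first y e d =
    trans (entry′-setEntry-other (setEntry U i₁ j₁ v₁) i₂ j₂ v₂ i₁ j₁ d) (entry′-setEntry-defined U i₁ j₁ v₁ y e)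

  unchanged : ∀ i j → i ≢ i₁ ⊎ j ≢ j₁ → i ≢ i₂ ⊎ j ≢ j₂ → entry′ written i j ≡ entry′ U i j
  unchanged i j d₁ d₂ =
    trans (entry′-setEntry-other (setEntry U i₁ j₁ v₁) i₂ j₂ v₂ i j d₂) (entry′-setEntry-other U i₁ j₁ v₁ i j d₁)

  rowsNonEmpty-written : RowsNonEmpty U → RowsNonEmpty written
  rowsNonEmpty-written ne = rowsNonEmpty-setEntry (setEntry U i₁ j₁ v₁) i₂ j₂ v₂ (rowsNonEmpty-setEntry U i₁ j₁ v₁ ne)

  size-written : size written ≡ size U
  size-written = trans (size-setEntry (setEntry U i₁ j₁ v₁) i₂ j₂ v₂) (size-setEntry U i₁ j₁ v₁)

-- U is T after the hole (value 0) has travelled from (0 , 0) down to (k , 0)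
-- and then right to (k , j).
record SlideState (T : Tableau) (k j : ℕ) (U : Tableau) : Set where
  field
    shifted-up   : ∀ i → i < k → entry′ U i 0 ≡ entry′ T (suc i) 0
    shifted-left : ∀ j′ → j′ < j → entry′ U k j′ ≡ entry′ T k (suc j′)
    hole         : entry′ U k j ≡ just 0
    untouched    : ∀ i j′ → ¬ (i < k × j′ ≡ 0) → ¬ (i ≡ k × j′ ≤ j) → entry′ U i j′ ≡ entry′ T i j′
    rowsNonEmpty : RowsNonEmpty U
    size-same    : size U ≡ size T

module SlidePath
  (T : Tableau) (a : ℕ)
  (moves-down : ∀ k → k < a → SlidesDown T k)
  (moves-right : ∀ j x → entry′ T (suc a) j ≡ just x → ∃ λ r → entry′ T a (suc j) ≡ just r × r < x)
  (p : ℕ) (end-defined : Defined (entry′ T a p)) (after-end : entry′ T a (suc p) ≡ nothing) where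

  SlideResult : Tableau → ℕ → ℕ → ℕ → Set
  SlideResult U₀ fuel k j = ∃ λ U → SlideState T a p U × slide fuel U₀ k j ≡ (removeCell U a , (a , p))

  below-end : entry′ T (suc a) p ≡ nothing
  below-end with entry′ T (suc a) p in e
  ... | nothing = refl
  ... | just x with moves-right p x e
  ... | r , er , _ = ⊥-elim (just≢nothing (trans (sym er) after-end))

  state-right : ∀ j U r → SlideState T a j U → entry′ T a (suc j) ≡ just r →
                SlideState T a (suc j) (setEntry (setEntry U a j r) a (suc j) 0)
  state-right j U r S er = record
    { shifted-up = up′ ; shifted-left = left′ ; hole = hole′ ; untouched = untouched′
    ; rowsNonEmpty = W.rowsNonEmpty-written rowsNonEmpty
    ; size-same = trans W.size-written size-same }
    where
    open SlideState S
    module W = TwoWrites U a j r a (suc j) 0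
    up′ : ∀ i → i < a → entry′ W.written i 0 ≡ entry′ T (suc i) 0
    up′ i lt = trans (W.unchanged i 0 (inj₁ (<⇒≢ lt)) (inj₁ (<⇒≢ lt))) (shifted-up i lt)
    left′ : ∀ j′ → j′ < suc j → entry′ W.written a j′ ≡ entry′ T a (suc j′)
    left′ j′ (s≤s le) with m≤n⇒m<n∨m≡n le
    ... | inj₁ lt   = trans (W.unchanged a j′ (inj₂ (<⇒≢ lt)) (inj₂ (<⇒≢ (m≤n⇒m≤1+n lt)))) (shifted-left j′ lt)
    ... | inj₂ refl = trans (W.written-first 0 hole (inj₂ (≢-sym 1+n≢n))) (sym er)
    hole′ : entry′ W.written a (suc j) ≡ just 0
    hole′ = W.written-second r
              (trans (untouched a (suc j) (λ { (lt , _) → <-irrefl refl lt }) (λ { (_ , le) → 1+n≰n le })) er)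
              (inj₂ 1+n≢n)
    untouched′ : ∀ i j′ → ¬ (i < a × j′ ≡ 0) → ¬ (i ≡ a × j′ ≤ suc j) → entry′ W.written i j′ ≡ entry′ T i j′
    untouched′ i j′ n₁ n₂ =
      trans (W.unchanged i j′ d₁ d₂) (untouched i j′ n₁ (λ { (e , le) → n₂ (e , m≤n⇒m≤1+n le) }))
      where
      d₁ : i ≢ a ⊎ j′ ≢ j
      d₁ with i ≟ a
      ... | no n  = inj₁ n
      ... | yes e = inj₂ λ { refl → n₂ (e , n≤1+n j′) }
      d₂ : i ≢ a ⊎ j′ ≢ suc j
      d₂ with i ≟ a
      ... | no n  = inj₁ n
      ... | yes e = inj₂ λ { refl → n₂ (e , ≤-refl) }

  state-down : ∀ k U b → k < a → SlideState T k 0 U → entry′ T (suc k) 0 ≡ just b →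
               SlideState T (suc k) 0 (setEntry (setEntry U k 0 b) (suc k) 0 0)
  state-down k U b k<a S eb = record
    { shifted-up = up′ ; shifted-left = λ j′ () ; hole = hole′ ; untouched = untouched′
    ; rowsNonEmpty = W.rowsNonEmpty-written rowsNonEmpty
    ; size-same = trans W.size-written size-same }
    where
    open SlideState S
    module W = TwoWrites U k 0 b (suc k) 0 0
    up′ : ∀ i → i < suc k → entry′ W.written i 0 ≡ entry′ T (suc i) 0
    up′ i (s≤s le) with m≤n⇒m<n∨m≡n le
    ... | inj₁ lt   = trans (W.unchanged i 0 (inj₁ (<⇒≢ lt)) (inj₁ (<⇒≢ (m≤n⇒m≤1+n lt)))) (shifted-up i lt)
    ... | inj₂ refl = trans (W.written-first 0 hole (inj₁ (≢-sym 1+n≢n))) (sym eb)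
    hole′ : entry′ W.written (suc k) 0 ≡ just 0
    hole′ = W.written-second b
              (trans (untouched (suc k) 0 (λ { (lt , _) → 1+n≰n (<⇒≤ lt) }) (λ { (e , _) → 1+n≢n e })) eb)
              (inj₁ 1+n≢n)
    untouched′ : ∀ i j′ → ¬ (i < suc k × j′ ≡ 0) → ¬ (i ≡ suc k × j′ ≤ 0) → entry′ W.written i j′ ≡ entry′ T i j′
    untouched′ i j′ n₁ n₂ =
      trans (W.unchanged i j′ d₁ d₂)
            (untouched i j′ (λ { (lt , e) → n₁ (m≤n⇒m≤1+n lt , e) }) (λ { (refl , le) → n₁ (≤-refl , n≤0⇒n≡0 le) }))
      where
      d₁ : i ≢ k ⊎ j′ ≢ 0
      d₁ with i ≟ k
      ... | no n     = inj₁ n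
      ... | yes refl = inj₂ λ e → n₁ (≤-refl , e)
      d₂ : i ≢ suc k ⊎ j′ ≢ 0
      d₂ with i ≟ suc k
      ... | no n  = inj₁ n
      ... | yes e = inj₂ λ { refl → n₂ (e , z≤n) }

  -- The fuel bounds are the remaining path lengths p ∸ j and (a ∸ k) + p.
  fuel-right : ∀ {j fuel} → j < p → p ∸ j ≤ suc fuel → p ∸ suc j ≤ fuel
  fuel-right {j} lt f = ≤-pred (≤-trans (≤-reflexive (sym (+-∸-assoc 1 lt))) f)

  fuel-down : ∀ {k fuel} → k < a → (a ∸ k) + p ≤ suc fuel → (a ∸ suc k) + p ≤ fuel
  fuel-down {k} lt f = ≤-pred (≤-trans (≤-reflexive (cong (_+ p) (sym (+-∸-assoc 1 lt)))) f)

  slide-right : ∀ fuel j U → j ≤ p → p ∸ j ≤ fuel → SlideState T a j U → SlideResult U fuel a j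
  slide-right zero j U j≤p f S with m≤n⇒m<n∨m≡n j≤p
  ... | inj₂ refl = U , S , refl
  ... | inj₁ lt   = ⊥-elim (<⇒≱ (m<n⇒0<n∸m lt) f)
  slide-right (suc fuel) j U j≤p f S with m≤n⇒m<n∨m≡n j≤p
  ... | inj₂ refl rewrite entry≡entry′ U a (suc j) | entry≡entry′ U (suc a) j
          | SlideState.untouched S a (suc j) (λ { (lt , _) → <-irrefl refl lt }) (λ { (_ , le) → 1+n≰n le })
          | SlideState.untouched S (suc a) j (λ { (lt , _) → 1+n≰n (<⇒≤ lt) }) (λ { (e , _) → 1+n≢n e })
          | after-end | below-end = U , S , refl
  ... | inj₁ lt with defined-left* T a (suc j) p lt end-defined
  ... | r , er rewrite entry≡entry′ U a (suc j) | entry≡entry′ U (suc a) j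
          | SlideState.untouched S a (suc j) (λ { (lt , _) → <-irrefl refl lt }) (λ { (_ , le) → 1+n≰n le })
          | SlideState.untouched S (suc a) j (λ { (lt , _) → 1+n≰n (<⇒≤ lt) }) (λ { (e , _) → 1+n≢n e })
          | er with entry′ T (suc a) j in eb
  ... | nothing = slide-right fuel (suc j) _ lt (fuel-right lt f) (state-right j U r S er)
  ... | just b with moves-right j b eb
  ... | r′ , er′ , r′<b rewrite just-injective (trans (sym er) er′) | <ᵇ≡true r′ b r′<b =
          slide-right fuel (suc j) _ lt (fuel-right lt f) (state-right j U r′ S er′)

  slide-down : ∀ fuel k U → k ≤ a → (a ∸ k) + p ≤ fuel → SlideState T k 0 U → SlideResult U fuel k 0
  slide-down fuel k U k≤a f S with m≤n⇒m<n∨m≡n k≤a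
  ... | inj₂ refl = slide-right fuel 0 U z≤n (≤-trans (≤-reflexive (sym (cong (_+ p) (n∸n≡0 k)))) f) S
  slide-down zero k U k≤a f S | inj₁ lt = ⊥-elim (<⇒≱ (≤-trans (m<n⇒0<n∸m lt) (m≤m+n (a ∸ k) p)) f)
  slide-down (suc fuel) k U k≤a f S | inj₁ lt with moves-down k lt
  ... | b , eb , b≤ rewrite entry≡entry′ U k 1 | entry≡entry′ U (suc k) 0
          | SlideState.untouched S k 1 (λ { (lt , _) → <-irrefl refl lt }) (λ { (_ , ()) })
          | SlideState.untouched S (suc k) 0 (λ { (lt , _) → 1+n≰n (<⇒≤ lt) }) (λ { (e , _) → 1+n≢n e })
          | eb with entry′ T k 1
  ... | nothing = slide-down fuel (suc k) _ lt (fuel-down lt f) (state-down k U b lt S eb)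
  ... | just r rewrite <ᵇ≡false r b (b≤ r refl) = slide-down fuel (suc k) _ lt (fuel-down lt f) (state-down k U b lt S eb)

-- Interlacing propagates the failure of the hole to move down from (a , 0)
-- along row a + 1: once the hole leaves the first column it only moves right.
blocked-row : ∀ {T} → Admissible T → ∀ a → ¬ SlidesDown T a →
              ∀ j x → entry′ T (suc a) j ≡ just x → ∃ λ r → entry′ T a (suc j) ≡ just r × r < x
blocked-row {T} A a stuck zero x ex with entry′ T a 1
... | nothing = ⊥-elim (stuck (x , ex , λ r ()))
... | just r with r <? x
... | yes r<x = r , refl , r<x
... | no  r≮x = ⊥-elim (stuck (x , ex , λ r′ e → subst (x ≤_) (just-injective e) (≮⇒≥ r≮x)))
blocked-row {T} A a stuck (suc j) x ex
  with defined-left T (suc a) j (x , ex)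
... | x₀ , ex₀ with blocked-row A a stuck j x₀ ex₀
... | r , er , r<x₀
  with Admissible.interlacing A a (suc j) x ex (suc a) j x₀ ≤-refl ex₀ (Admissible.rowIncreasing A (suc a) j x₀ x ex₀ ex)
... | j′ , w , ew , x₀≤w , w<x with AdmissibleProperties.row-<-reflects A a (suc j) j′ r w er ew (<-≤-trans r<x₀ x₀≤w)
... | j<j′ with defined-left* T a (suc (suc j)) j′ j<j′ (w , ew)
... | r′ , er′ = r′ , er′ , ≤-<-trans (AdmissibleProperties.row-mono A a (suc (suc j)) j′ r′ w j<j′ er′ ew) w<x

record Promotion (T : Tableau) : Set where
  field
    row col      : ℕ
    moves-down   : ∀ k → k < row → SlidesDown T k
    stuck        : ¬ SlidesDown T row
    end-defined  : Defined (entry′ T row col)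
    after-end    : entry′ T row (suc col) ≡ nothing
    corner       : proj₂ (promote T) ≡ (row , col)
    column-shift : ∀ i → i < row → entry′ (proj₁ (promote T)) i 0 ≡ Maybe.map pred (entry′ T (suc i) 0)
    row-shift    : ∀ j → entry′ (proj₁ (promote T)) row j ≡ Maybe.map pred (entry′ T row (suc j))
    elsewhere    : ∀ i j → ¬ (i < row × j ≡ 0) → i ≢ row →
                   entry′ (proj₁ (promote T)) i j ≡ Maybe.map pred (entry′ T i j)
    size-promote : suc (size (proj₁ (promote T))) ≡ size T
    rowsNonEmpty-promote : RowsNonEmpty (proj₁ (promote T))

promote-≡ : ∀ T X c → slide (size T) (setEntry T 0 0 0) 0 0 ≡ (X , c) → promote T ≡ (map (map pred) X , c)
promote-≡ T X c e with slide (size T) (setEntry T 0 0 0) 0 0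
promote-≡ T X c refl | .(X , c) = refl

module Promote (T : Tableau) (A : Admissible T) (x₀₀ : ℕ) (e₀₀ : entry′ T 0 0 ≡ just x₀₀) where

  a : ℕ
  a = proj₁ (exitRow T)

  moves-down : ∀ k → k < a → SlidesDown T k
  moves-down = proj₁ (proj₂ (exitRow T))

  stuck : ¬ SlidesDown T a
  stuck = proj₂ (proj₂ (exitRow T))

  moves-right : ∀ j x → entry′ T (suc a) j ≡ just x → ∃ λ r → entry′ T a (suc j) ≡ just r × r < x
  moves-right = blocked-row A a stuck

  col0-defined : ∀ k → k ≤ a → Defined (entry′ T k 0)
  col0-defined zero    _  = x₀₀ , e₀₀
  col0-defined (suc k) le with moves-down k le
  ... | b , eb , _ = b , eb

  end : ∃ (RowEndsAt T a)
  end = row-end T a (proj₁ (col0-defined a ≤-refl)) (proj₂ (col0-defined a ≤-refl))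

  p : ℕ
  p = proj₁ end

  end-defined : Defined (entry′ T a p)
  end-defined = proj₁ (proj₂ end)

  after-end : entry′ T a (suc p) ≡ nothing
  after-end = proj₂ (proj₂ end)

  open SlidePath T a moves-down moves-right p end-defined after-end

  initial-state : SlideState T 0 0 (setEntry T 0 0 0)
  initial-state = record
    { shifted-up = λ i () ; shifted-left = λ j () ; hole = entry′-setEntry-defined T 0 0 0 x₀₀ e₀₀
    ; untouched = λ i j _ n → entry′-setEntry-other T 0 0 0 i j (off-origin i j n)
    ; rowsNonEmpty = rowsNonEmpty-setEntry T 0 0 0 (Admissible.rowsNonEmpty A) ; size-same = size-setEntry T 0 0 0 }
    where
    off-origin : ∀ i j → ¬ (i ≡ 0 × j ≤ 0) → i ≢ 0 ⊎ j ≢ 0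
    off-origin zero    zero    n = ⊥-elim (n (refl , z≤n))
    off-origin zero    (suc j) n = inj₂ (λ ())
    off-origin (suc i) j       n = inj₁ (λ ())

  enough-fuel : (a ∸ 0) + p ≤ size (setEntry T 0 0 0)
  enough-fuel = ≤-trans (<⇒≤ (cell-bound T a p (Admissible.rowsNonEmpty A) end-defined)) (≤-reflexive (sym (size-setEntry T 0 0 0)))

  result : SlideResult (setEntry T 0 0 0) (size (setEntry T 0 0 0)) 0 0
  result = slide-down (size (setEntry T 0 0 0)) 0 (setEntry T 0 0 0) z≤n enough-fuel initial-state

  U : Tableau
  U = proj₁ result
  open SlideState (proj₁ (proj₂ result))

  promote≡ : promote T ≡ (map (map pred) (removeCell U a) , (a , p))
  promote≡ = promote-≡ T (removeCell U a) (a , p)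
               (subst (λ s → slide s (setEntry T 0 0 0) 0 0 ≡ (removeCell U a , (a , p)))
                      (size-setEntry T 0 0 0) (proj₂ (proj₂ result)))

  hole-row : ∃ λ r → nth U a ≡ just r × length r ≡ suc p
  hole-row = last-cell⇒row-length U a p 0 hole
               (trans (untouched a (suc p) (λ { (lt , _) → <-irrefl refl lt }) (λ { (_ , le) → 1+n≰n le })) after-end)

  r : List ℕ
  r = proj₁ hole-row

  nr : nth U a ≡ just r
  nr = proj₁ (proj₂ hole-row)

  length-r : length r ≡ suc p
  length-r = proj₂ (proj₂ hole-row)

  emptied-row-is-last : length r ≡ 1 → nth U (suc a) ≡ nothing
  emptied-row-is-last l₁ = row-absent U (suc a) rowsNonEmpty
    (trans (untouched (suc a) 0 (λ { (lt , _) → 1+n≰n (<⇒≤ lt) }) (λ { (e , _) → 1+n≢n e }))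
           (subst (λ q → entry′ T (suc a) q ≡ nothing) (suc-injective (trans (sym length-r) l₁)) below-end))

  T′ : Tableau
  T′ = map (map pred) (removeCell U a)

  removeCell-other : ∀ i j → i ≢ a ⊎ suc j ≢ length r → entry′ T′ i j ≡ Maybe.map pred (entry′ U i j)
  removeCell-other i j d =
    trans (entry′-map pred (removeCell U a) i j)
          (cong (Maybe.map pred) (entry′-removeCell-other U a r rowsNonEmpty nr emptied-row-is-last i j d))

  column-shift : ∀ i → i < a → entry′ T′ i 0 ≡ Maybe.map pred (entry′ T (suc i) 0)
  column-shift i lt = trans (removeCell-other i 0 (inj₁ (<⇒≢ lt))) (cong (Maybe.map pred) (shifted-up i lt))

  elsewhere : ∀ i j → ¬ (i < a × j ≡ 0) → i ≢ a → entry′ T′ i j ≡ Maybe.map pred (entry′ T i j)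
  elsewhere i j n₁ n₂ =
    trans (removeCell-other i j (inj₁ n₂)) (cong (Maybe.map pred) (untouched i j n₁ (λ { (e , _) → n₂ e })))

  row-shift : ∀ j → entry′ T′ a j ≡ Maybe.map pred (entry′ T a (suc j))
  row-shift j with <-cmp j p
  ... | tri< j<p _ _ =
    trans (removeCell-other a j (inj₂ (λ e → <-irrefl (suc-injective (trans e length-r)) j<p)))
          (cong (Maybe.map pred) (shifted-left j j<p))
  ... | tri≈ _ refl _ =
    trans (entry′-map pred (removeCell U a) a j)
          (cong (Maybe.map pred) (trans (subst (λ q → entry′ (removeCell U a) a q ≡ nothing) (cong pred length-r)
                                               (entry′-removeCell-same U a r rowsNonEmpty nr emptied-row-is-last))
                                        (sym after-end)))
  ... | tri> _ _ p<j =
    trans (removeCell-other a j (inj₂ (λ e → <-irrefl (sym (suc-injective (trans e length-r))) p<j)))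
          (cong (Maybe.map pred)
            (trans (untouched a j (λ { (lt , _) → <-irrefl refl lt }) (λ { (_ , le) → <⇒≱ p<j le }))
                   (trans (beyond-row-end T a p j after-end p<j)
                          (sym (beyond-row-end T a p (suc j) after-end (m≤n⇒m≤1+n p<j))))))

  transport : (P : Tableau → Set) → P T′ → P (proj₁ (promote T))
  transport P = subst P (sym (cong proj₁ promote≡))

  promotion : Promotion T
  promotion = record
    { row = a ; col = p ; moves-down = moves-down ; stuck = stuck
    ; end-defined = end-defined ; after-end = after-end
    ; corner = cong proj₂ promote≡
    ; column-shift = λ i lt → transport (λ X → entry′ X i 0 ≡ Maybe.map pred (entry′ T (suc i) 0)) (column-shift i lt)
    ; row-shift = λ j → transport (λ X → entry′ X a j ≡ Maybe.map pred (entry′ T a (suc j))) (row-shift j)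
    ; elsewhere = λ i j n₁ n₂ → transport (λ X → entry′ X i j ≡ Maybe.map pred (entry′ T i j)) (elsewhere i j n₁ n₂)
    ; size-promote = transport (λ X → suc (size X) ≡ size T)
        (trans (cong suc (size-map pred (removeCell U a)))
               (trans (size-removeCell U a r nr (subst (0 <_) (sym length-r) (s≤s z≤n))) size-same))
    ; rowsNonEmpty-promote = transport RowsNonEmpty (rowsNonEmpty-map pred (removeCell U a) (rowsNonEmpty-removeCell U a))
    }

map-just⁻ : ∀ {f : ℕ → ℕ} m y → Maybe.map f m ≡ just y → ∃ λ x → m ≡ just x × f x ≡ y
map-just⁻ (just x) _ refl = x , refl , refl

entryAt : Tableau → ℕ × ℕ → Maybe ℕ
entryAt T (i , j) = entry′ T i j

data CellKind (row i j : ℕ) : Set where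
  column-cell : i < row → j ≡ 0 → CellKind row i j
  exit-row-cell : i ≡ row → CellKind row i j
  other-cell : ¬ (i < row × j ≡ 0) → i ≢ row → CellKind row i j

cellKind : ∀ row i j → CellKind row i j
cellKind row i j with i ≟ row
... | yes e = exit-row-cell e
... | no n with i <? row | j ≟ 0
... | yes lt | yes e = column-cell lt e
... | yes lt | no nz = other-cell (λ { (_ , e) → nz e }) n
... | no nlt | _ = other-cell (λ { (lt , _) → nlt lt }) n

-- The cell of T whose entry, decremented, lands at (i , j) after a promotion
-- whose slide leaves the first column in row `row`.
origin : ℕ → ℕ → ℕ → ℕ × ℕ
origin row i j with cellKind row i j
... | column-cell _ _ = (suc i , 0)
... | exit-row-cell _ = (row , suc j)
... | other-cell _ _ = (i , j)

origin-injective : ∀ row i j i′ j′ → origin row i j ≡ origin row i′ j′ → i ≡ i′ × j ≡ j′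
origin-injective row i j i′ j′ e with cellKind row i j | cellKind row i′ j′
... | column-cell lt z | column-cell lt′ z′ = suc-injective (cong proj₁ e) , trans z (sym z′)
... | column-cell lt z | exit-row-cell e′ = ⊥-elim (0≢1+n (cong proj₂ e))
... | column-cell lt z | other-cell n₁ n₂ =
  ⊥-elim (n₁ (subst (_< row) (cong proj₁ e) (≤∧≢⇒< lt (λ q → n₂ (trans (sym (cong proj₁ e)) q))) , sym (cong proj₂ e)))
... | exit-row-cell e₁ | column-cell lt z = ⊥-elim (0≢1+n (sym (cong proj₂ e)))
... | exit-row-cell e₁ | exit-row-cell e₂ = trans e₁ (sym e₂) , suc-injective (cong proj₂ e)
... | exit-row-cell e₁ | other-cell n₁ n₂ = ⊥-elim (n₂ (sym (cong proj₁ e)))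
... | other-cell n₁ n₂ | column-cell lt z =
  ⊥-elim (n₁ (subst (_< row) (sym (cong proj₁ e)) (≤∧≢⇒< lt (λ q → n₂ (trans (cong proj₁ e) q))) , cong proj₂ e))
... | other-cell n₁ n₂ | exit-row-cell e₁ = ⊥-elim (n₂ (cong proj₁ e))
... | other-cell n₁ n₂ | other-cell m₁ m₂ = cong proj₁ e , cong proj₂ e

origin-column : ∀ row i → i < row → origin row i 0 ≡ (suc i , 0)
origin-column row i lt with cellKind row i 0
... | column-cell _ _ = refl
... | exit-row-cell e = ⊥-elim (<-irrefl e lt)
... | other-cell n₁ n₂ = ⊥-elim (n₁ (lt , refl))

origin-exit-row : ∀ row j → origin row row j ≡ (row , suc j)
origin-exit-row row j with cellKind row row j
... | column-cell lt _ = ⊥-elim (<-irrefl refl lt)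
... | exit-row-cell e = refl
... | other-cell n₁ n₂ = ⊥-elim (n₂ refl)

origin-other : ∀ row i j → ¬ (i < row × j ≡ 0) → i ≢ row → origin row i j ≡ (i , j)
origin-other row i j m₁ m₂ with cellKind row i j
... | column-cell lt z = ⊥-elim (m₁ (lt , z))
... | exit-row-cell e = ⊥-elim (m₂ e)
... | other-cell n₁ n₂ = refl

row≤origin-row : ∀ row i j → i ≤ proj₁ (origin row i j)
row≤origin-row row i j with cellKind row i j
... | column-cell _ _ = n≤1+n i
... | exit-row-cell e = ≤-reflexive e
... | other-cell _ _ = ≤-refl

origin-off-corner : ∀ row i j → proj₁ (origin row i j) ≢ 0 ⊎ proj₂ (origin row i j) ≢ 0
origin-off-corner row i j with cellKind row i j
... | column-cell _ _ = inj₁ (λ ())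
... | exit-row-cell e = inj₂ (λ ())
... | other-cell n₁ n₂ with i | j
... | suc i′ | _ = inj₁ (λ ())
... | zero | suc j′ = inj₂ (λ ())
... | zero | zero with row
... | zero = ⊥-elim (n₂ refl)
... | suc a′ = ⊥-elim (n₁ (s≤s z≤n , refl))

pred-< : ∀ {x y} → 1 ≤ x → x < y → pred x < pred y
pred-< {suc x} {suc y} _ (s≤s lt) = lt

module PromotionPreserves {T : Tableau} (A : Admissible T) (P : Promotion T) where
  open Promotion P
  open Admissible A
  open AdmissibleProperties A

  T′ : Tableau
  T′ = proj₁ (promote T)

  moves-right : ∀ j x → entry′ T (suc row) j ≡ just x → ∃ λ r → entry′ T row (suc j) ≡ just r × r < x
  moves-right = blocked-row A row stuck

  promoted-entry : ∀ i j → entry′ T′ i j ≡ Maybe.map pred (entryAt T (origin row i j))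
  promoted-entry i j with cellKind row i j
  ... | column-cell lt refl = column-shift i lt
  ... | exit-row-cell refl = row-shift j
  ... | other-cell n₁ n₂ = elsewhere i j n₁ n₂

  promoted⇒origin : ∀ i j x′ → entry′ T′ i j ≡ just x′ → ∃ λ x → entryAt T (origin row i j) ≡ just x × pred x ≡ x′
  promoted⇒origin i j x′ e = map-just⁻ (entryAt T (origin row i j)) x′ (trans (sym (promoted-entry i j)) e)

  origin⇒promoted : ∀ i j x → entryAt T (origin row i j) ≡ just x → entry′ T′ i j ≡ just (pred x)
  origin⇒promoted i j x e = trans (promoted-entry i j) (cong (Maybe.map pred) e)

  origin-entry : ∀ {i j r q x} → origin row i j ≡ (r , q) → entry′ T r q ≡ just x → entryAt T (origin row i j) ≡ just x
  origin-entry e ex rewrite e = ex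

  origin-entry⁻ : ∀ {i j r q x} → origin row i j ≡ (r , q) → entryAt T (origin row i j) ≡ just x → entry′ T r q ≡ just x
  origin-entry⁻ e ex rewrite e = ex

  origin-≥2 : ∀ i j x → entryAt T (origin row i j) ≡ just x → 2 ≤ x
  origin-≥2 i j x e = off-corner⇒≥2 (proj₁ (origin row i j)) (proj₂ (origin row i j)) x e (origin-off-corner row i j)

  positive′ : ∀ i j x′ → entry′ T′ i j ≡ just x′ → 1 ≤ x′
  positive′ i j x′ e with promoted⇒origin i j x′ e
  ... | x , ex , refl = pred-mono-≤ (origin-≥2 i j x ex)

  injective′ : ∀ i j i′ j′ x′ → entry′ T′ i j ≡ just x′ → entry′ T′ i′ j′ ≡ just x′ → i ≡ i′ × j ≡ j′
  injective′ i j i′ j′ x′ e₁ e₂ with promoted⇒origin i j x′ e₁ | promoted⇒origin i′ j′ x′ e₂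
  ... | x , ex , q₁ | y , ey , q₂ =
    origin-injective row i j i′ j′ (cong₂ _,_ (proj₁ same) (proj₂ same))
    where
    xy : x ≡ y
    xy = pred-injective {{>-nonZero (<-trans z<s (origin-≥2 i j x ex))}} {{>-nonZero (<-trans z<s (origin-≥2 i′ j′ y ey))}}
                        (trans q₁ (sym q₂))
    same : proj₁ (origin row i j) ≡ proj₁ (origin row i′ j′) × proj₂ (origin row i j) ≡ proj₂ (origin row i′ j′)
    same = injective _ _ _ _ x ex (subst (λ v → entryAt T (origin row i′ j′) ≡ just v) (sym xy) ey)

  <-from-origins : ∀ i j i′ j′ x′ y′ x y → entry′ T′ i j ≡ just x′ → entry′ T′ i′ j′ ≡ just y′ →
         entryAt T (origin row i j) ≡ just x → entryAt T (origin row i′ j′) ≡ just y → x < y → x′ < y′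
  <-from-origins i j i′ j′ x′ y′ x y e₁ e₂ ex ey lt with promoted⇒origin i j x′ e₁ | promoted⇒origin i′ j′ y′ e₂
  ... | x₀ , ex₀ , refl | y₀ , ey₀ , refl
    rewrite just-injective (trans (sym ex₀) ex) | just-injective (trans (sym ey₀) ey) = pred-< (≤-trans (s≤s z≤n) (origin-≥2 i j x ex)) lt

  column-<-right : ∀ k b r → k < row → entry′ T (suc k) 0 ≡ just b → entry′ T k 1 ≡ just r → b < r
  column-<-right k b r lt eb er with moves-down k lt
  ... | b′ , eb′ , f with just-injective (trans (sym eb′) eb)
  ... | refl = ≤∧≢⇒< (f r er) (λ { refl → 0≢1+n (proj₂ (injective (suc k) 0 k 1 b eb er)) })

  promoted-entry-at : ∀ {i j r q} → origin row i j ≡ (r , q) → entry′ T′ i j ≡ Maybe.map pred (entry′ T r q)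
  promoted-entry-at {i} {j} e = trans (promoted-entry i j) (cong (λ c → Maybe.map pred (entryAt T c)) e)

  defined-from-origin : ∀ {i j r q} → origin row i j ≡ (r , q) → Defined (entry′ T r q) → Defined (entry′ T′ i j)
  defined-from-origin e (x , ex) = pred x , trans (promoted-entry-at e) (cong (Maybe.map pred) ex)

  defined-origin : ∀ {i j r q} → origin row i j ≡ (r , q) → Defined (entry′ T′ i j) → Defined (entry′ T r q)
  defined-origin {r = r} {q} e (x′ , ex′) with map-just⁻ (entry′ T r q) x′ (trans (sym (promoted-entry-at e)) ex′)
  ... | x , ex , _ = x , ex

  origin-other′ : ∀ i j → i ≢ row → (i < row → j ≢ 0) → origin row i j ≡ (i , j)
  origin-other′ i j n ln = origin-other row i j (λ { (lt , z) → ln lt z }) n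

  defined-up′ : ∀ i j → Defined (entry′ T′ (suc i) j) → Defined (entry′ T′ i j)
  defined-up′ i j d with cellKind row (suc i) j
  ... | column-cell lt refl = defined-from-origin (origin-column row i (≤-trans (n≤1+n _) lt))
                       (defined-up (suc i) 0 (defined-origin (origin-column row (suc i) lt) d))
  ... | exit-row-cell e with defined-origin (subst (λ k → origin row k j ≡ (row , suc j)) (sym e) (origin-exit-row row j)) d
  ... | dd with j
  ... | zero = defined-from-origin (origin-column row i (≤-reflexive e))
                 (subst (λ k → Defined (entry′ T k 0)) (sym e) (defined-left* T row 0 1 z≤n dd))
  ... | suc j′ = defined-from-origin (origin-other′ i (suc j′) (λ q → 1+n≢n (trans e (sym q))) (λ _ ()))
                   (defined-up i (suc j′) (subst (λ k → Defined (entry′ T k (suc j′))) (sym e) (defined-left T row (suc j′) dd)))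
  defined-up′ i j d | other-cell n₁ n₂ with defined-origin (origin-other row (suc i) j n₁ n₂) d
  ... | dd with <-cmp i row
  ... | tri≈ _ refl _ = defined-from-origin (origin-exit-row i j) (let (r , er , _) = moves-right j (proj₁ dd) (proj₂ dd) in r , er)
  ... | tri> nlt n _ = defined-from-origin (origin-other′ i j n (λ lt → ⊥-elim (nlt lt))) (defined-up i j dd)
  ... | tri< lt n _ = defined-from-origin (origin-other′ i j n (λ _ z → n₁ (≤∧≢⇒< lt n₂ , z))) (defined-up i j dd)

  <-via-origins : ∀ {i j i′ j′ r q r′ q′ x′ y′} → origin row i j ≡ (r , q) → origin row i′ j′ ≡ (r′ , q′) →
          entry′ T′ i j ≡ just x′ → entry′ T′ i′ j′ ≡ just y′ →
          (∀ x y → entry′ T r q ≡ just x → entry′ T r′ q′ ≡ just y → x < y) → x′ < y′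
  <-via-origins {i} {j} {i′} {j′} {x′ = x′} {y′} s₁ s₂ e₁ e₂ f
    with promoted⇒origin i j x′ e₁ | promoted⇒origin i′ j′ y′ e₂
  ... | x , ex , _ | y , ey , _ =
    <-from-origins i j i′ j′ x′ y′ x y e₁ e₂ ex ey (f x y (origin-entry⁻ s₁ ex) (origin-entry⁻ s₂ ey))

  rowIncreasing′ : ∀ i j x′ y′ → entry′ T′ i j ≡ just x′ → entry′ T′ i (suc j) ≡ just y′ → x′ < y′
  rowIncreasing′ i j x′ y′ e₁ e₂ with <-cmp i row
  ... | tri≈ _ refl _ = <-via-origins (origin-exit-row i j) (origin-exit-row i (suc j)) e₁ e₂
                          (λ x y → rowIncreasing i (suc j) x y)
  ... | tri> nlt n _ = <-via-origins (origin-other′ i j n (⊥-elim ∘′ nlt)) (origin-other′ i (suc j) n (⊥-elim ∘′ nlt)) e₁ e₂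
                          (λ x y → rowIncreasing i j x y)
  ... | tri< lt n _ with j
  ... | zero = <-via-origins (origin-column row i lt) (origin-other′ i 1 n (λ _ ())) e₁ e₂ (λ x y ex ey → column-<-right i x y lt ex ey)
  ... | suc j′ = <-via-origins (origin-other′ i (suc j′) n (λ _ ())) (origin-other′ i (suc (suc j′)) n (λ _ ())) e₁ e₂
                          (λ x y → rowIncreasing i (suc j′) x y)

  colIncreasing′ : ∀ i j x′ y′ → entry′ T′ i j ≡ just x′ → entry′ T′ (suc i) j ≡ just y′ → x′ < y′
  colIncreasing′ i j x′ y′ e₁ e₂ with <-cmp (suc i) row
  ... | tri< lt n _ with j
  ... | zero = <-via-origins (origin-column row i (≤-trans (n≤1+n _) lt)) (origin-column row (suc i) lt) e₁ e₂
                 (λ x y → colIncreasing (suc i) 0 x y)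
  ... | suc j′ = <-via-origins
                   (origin-other′ i (suc j′) (λ q → <-irrefl q (<-trans (n<1+n i) lt)) (λ _ ()))
                   (origin-other′ (suc i) (suc j′) n (λ _ ())) e₁ e₂
                 (λ x y → colIncreasing i (suc j′) x y)
  colIncreasing′ i j x′ y′ e₁ e₂ | tri≈ _ e _ with j
  ... | zero = <-via-origins (origin-column row i (≤-reflexive e))
                 (subst (λ k → origin row k 0 ≡ (k , 1)) (sym e) (origin-exit-row row 0)) e₁ e₂
                 (λ x y → rowIncreasing (suc i) 0 x y)
  ... | suc j′ = <-via-origins
                   (origin-other′ i (suc j′) (λ q → 1+n≢n (trans e (sym q))) (λ _ ()))
                   (subst (λ k → origin row k (suc j′) ≡ (k , suc (suc j′))) (sym e) (origin-exit-row row (suc j′))) e₁ e₂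
                 (λ x y ex ey → let (w , ew) = defined-left T (suc i) (suc j′) (y , ey) in
                     <-trans (colIncreasing i (suc j′) x w ex ew) (rowIncreasing (suc i) (suc j′) w y ew ey))
  colIncreasing′ i j x′ y′ e₁ e₂ | tri> nlt n gt with <-cmp i row
  ... | tri< lt _ _ = ⊥-elim (<-irrefl refl (≤-<-trans (≤-pred gt) lt))
  ... | tri≈ _ refl _ = <-via-origins (origin-exit-row i j) (origin-other′ (suc i) j n (λ l → ⊥-elim (nlt l))) e₁ e₂
                 (λ x y ex ey → let (r , er , lt) = moves-right j y ey in subst (_< y) (just-injective (trans (sym er) ex)) lt)
  ... | tri> nlt₂ n₂ _ = <-via-origins (origin-other′ i j n₂ (⊥-elim ∘′ nlt₂)) (origin-other′ (suc i) j n (⊥-elim ∘′ nlt)) e₁ e₂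
                 (λ x y → colIncreasing i j x y)

  Interlaced : ℕ → ℕ → ℕ → Set
  Interlaced i z x = ∃₂ λ j′ w → entryAt T (origin row i j′) ≡ just w × z ≤ w × w < x

  interlace-via-row-below : ∀ i x rz qz z → entry′ T rz qz ≡ just z → suc i ≤ rz → z < x → i < row →
          ∀ s → 0 < s → entry′ T (suc i) s ≡ just x → Interlaced i z x
  interlace-via-row-below i x rz qz z ez rzge zx lt s sp exS with interlacing i s x exS rz qz z rzge ez zx
  ... | suc j′ , w , ew , zw , wx = suc j′ , w , origin-entry (origin-other′ i (suc j′) (<⇒≢ lt) (λ _ ())) ew , zw , wx
  ... | zero , w , ew , zw , wx with defined-left* T (suc i) 0 s z≤n (x , exS)
  ... | c , ec = 0 , c , origin-entry (origin-column row i lt) ec , ≤-trans zw (<⇒≤ (colIncreasing i 0 w c ew ec)) ,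
                 row-strict (suc i) 0 s c x sp ec exS

  interlace-below-exit : ∀ i j x → row < i → entryAt T (origin row (suc i) j) ≡ just x →
                         ∀ rz qz z → entry′ T rz qz ≡ just z → suc i ≤ rz → z < x → Interlaced i z x
  interlace-below-exit i j x row<i ex rz qz z ez le z<x =
    let (j′ , w , ew , z≤w , w<x) = interlacing i j x (origin-entry⁻ unmoved ex) rz qz z le ez z<x
    in j′ , w , origin-entry (origin-other′ i j′ (>⇒≢ row<i) (λ i<row → ⊥-elim (<-asym i<row row<i))) ew , z≤w , w<x
    where
    unmoved : origin row (suc i) j ≡ (suc i , j)
    unmoved = origin-other′ (suc i) j (λ q → <-irrefl (sym q) (<-trans row<i (n<1+n i)))
                            (λ lt → ⊥-elim (<-asym row<i (<-trans (n<1+n i) lt)))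

  interlace-at-exit : ∀ j x → entryAt T (origin row (suc row) j) ≡ just x →
                      ∀ rz qz z → entry′ T rz qz ≡ just z → suc row ≤ rz → z < x → Interlaced row z x
  interlace-at-exit j x ex rz qz z ez le z<x
    with origin-entry⁻ (origin-other′ (suc row) j 1+n≢n (λ l → ⊥-elim (1+n≰n (<⇒≤ l)))) ex
  ... | exT with interlacing row j x exT rz qz z le ez z<x
  ... | suc j′ , w , ew , z≤w , w<x = j′ , w , origin-entry (origin-exit-row row j′) ew , z≤w , w<x
  ... | zero , w , ew , z≤w , w<x with defined-left* T (suc row) 0 j z≤n (x , exT)
  ... | x₀ , ex₀ with moves-right 0 x₀ ex₀
  ... | r , er , r<x₀ = 0 , r , origin-entry (origin-exit-row row 0) er ,
                        ≤-trans z≤w (<⇒≤ (rowIncreasing row 0 w r ew er)) ,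
                        <-≤-trans r<x₀ (row-mono (suc row) 0 j x₀ x z≤n ex₀ exT)

  -- Here x moved up from (i + 2 , 0).  Entries of row i + 1 off the first column
  -- are at least x, so the entry of row i + 1 squeezing z (possibly z itself) is
  -- T(i + 1 , 0), which moves up to (i , 0).
  interlace-column : ∀ i x → suc i < row → entry′ T (suc (suc i)) 0 ≡ just x →
                     ∀ rz qz z → entry′ T rz qz ≡ just z → suc i ≤ rz → z < x → Interlaced i z x
  interlace-column i x lt ex rz qz z ez le z<x with moves-down (suc i) lt
  ... | b , eb , b≤ with just-injective (trans (sym eb) ex)
  ... | refl with m≤n⇒m<n∨m≡n le
  interlace-column i x lt ex rz qz z ez le z<x | b , eb , b≤ | refl | inj₁ lt₃
    with interlacing (suc i) 0 x ex rz qz z lt₃ ez z<x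
  ... | zero , w , ew , z≤w , w<x = 0 , w , origin-entry (origin-column row i (<-trans (n<1+n i) lt)) ew , z≤w , w<x
  ... | suc j′ , w , ew , z≤w , w<x with defined-left* T (suc i) 1 (suc j′) (s≤s z≤n) (w , ew)
  ... | r , er = ⊥-elim (<⇒≱ w<x (≤-trans (b≤ r er) (row-mono (suc i) 1 (suc j′) r w (s≤s z≤n) er ew)))
  interlace-column i x lt ex (suc i) zero    z ez le z<x | _ | refl | inj₂ refl =
    0 , z , origin-entry (origin-column row i (<-trans (n<1+n i) lt)) ez , ≤-refl , z<x
  interlace-column i x lt ex (suc i) (suc q) z ez le z<x | b , eb , b≤ | refl | inj₂ refl
    with defined-left* T (suc i) 1 (suc q) (s≤s z≤n) (z , ez)
  ... | r , er = ⊥-elim (<⇒≱ z<x (≤-trans (b≤ r er) (row-mono (suc i) 1 (suc q) r z (s≤s z≤n) er ez)))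

  interlace-above-exit : ∀ i j x → i < row → entryAt T (origin row (suc i) j) ≡ just x →
                         ∀ rz qz z → entry′ T rz qz ≡ just z → suc i ≤ rz → z < x → Interlaced i z x
  interlace-above-exit i j x lt ex rz qz z ez le z<x with <-cmp (suc i) row
  ... | tri> _ _ gt = ⊥-elim (<-irrefl refl (<-≤-trans gt lt))
  ... | tri≈ _ e _ = interlace-via-row-below i x rz qz z ez le z<x lt (suc j) (s≤s z≤n)
                       (subst (λ k → entry′ T k (suc j) ≡ just x) (sym e)
                         (origin-entry⁻ (subst (λ k → origin row k j ≡ (row , suc j)) (sym e) (origin-exit-row row j)) ex))
  ... | tri< lt₂ n₂ _ with j
  ... | suc j₀ = interlace-via-row-below i x rz qz z ez le z<x lt (suc j₀) (s≤s z≤n)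
                   (origin-entry⁻ (origin-other′ (suc i) (suc j₀) n₂ (λ _ ())) ex)
  ... | zero = interlace-column i x lt₂ (origin-entry⁻ (origin-column row (suc i) lt₂) ex) rz qz z ez le z<x

  interlace-origin : ∀ i j x → entryAt T (origin row (suc i) j) ≡ just x →
                     ∀ rz qz z → entry′ T rz qz ≡ just z → suc i ≤ rz → z < x → Interlaced i z x
  interlace-origin i j x ex with <-cmp i row
  ... | tri< i<row _ _ = interlace-above-exit i j x i<row ex
  ... | tri≈ _ refl _  = interlace-at-exit j x ex
  ... | tri> _ _ row<i = interlace-below-exit i j x row<i ex

  interlacing′ : Interlacing T′
  interlacing′ i j x′ ex′ i₂ j₂ z′ le ez′ zx′ with promoted⇒origin (suc i) j x′ ex′ | promoted⇒origin i₂ j₂ z′ ez′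
  ... | x , ex , refl | z , ez , refl with interlace-origin i j x ex (proj₁ (origin row i₂ j₂)) (proj₂ (origin row i₂ j₂)) z ez
                                              (≤-trans le (row≤origin-row row i₂ j₂)) (pred-cancel-< zx′)
  ... | j′ , w , ew , zw , wx = j′ , pred w , origin⇒promoted i j′ w ew , pred-mono-≤ zw ,
                                pred-< (≤-trans (s≤s z≤n) (origin-≥2 i j′ w ew)) wx

  admissible′ : Admissible T′
  admissible′ = record
    { rowsNonEmpty = rowsNonEmpty-promote ; defined-up = defined-up′
    ; rowIncreasing = rowIncreasing′ ; colIncreasing = colIncreasing′
    ; positive = positive′ ; injective = injective′ ; interlacing = interlacing′ }


-- Holds for m when 1, …, m fill the top of the first column, and is inherited,
-- with m decreased, by each of the first m − 1 promotions.
record ColumnPrefix (U : Tableau) (m : ℕ) : Set where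
  field
    prefix-below : ∀ k → suc k < m → ∃ λ b → entry′ U (suc k) 0 ≡ just b × (∀ r → entry′ U 0 1 ≡ just r → b < r)
    next-above : ∀ b → entry′ U m 0 ≡ just b → ∃ λ r → entry′ U 0 1 ≡ just r × r < b

defined-map-pred : ∀ (m : Maybe ℕ) → Defined m → Defined (Maybe.map pred m)
defined-map-pred (just x) _ = pred x , refl

defined-map-pred⁻ : ∀ (m : Maybe ℕ) → Defined (Maybe.map pred m) → Defined m
defined-map-pred⁻ (just x) _ = x , refl
defined-map-pred⁻ nothing (_ , ())

module PromotionSteps {U : Tableau} (A : Admissible U) (P : Promotion U) where
  open Admissible A
  open AdmissibleProperties A
  open Promotion P
  U′ : Tableau
  U′ = proj₁ (promote U)

  defined-via : ∀ {i j m} → entry′ U′ i j ≡ Maybe.map pred m → Defined m → Defined (entry′ U′ i j)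
  defined-via {m = m} e d = subst Defined (sym e) (defined-map-pred m d)

  defined-back : ∀ {i j m} → entry′ U′ i j ≡ Maybe.map pred m → Defined (entry′ U′ i j) → Defined m
  defined-back {m = m} e d = defined-map-pred⁻ m (subst Defined e d)

  elsewhere′ : ∀ i j → (i < row → j ≢ 0) → i ≢ row → entry′ U′ i j ≡ Maybe.map pred (entry′ U i j)
  elsewhere′ i j f n = elsewhere i j (λ { (l , z) → f l z }) n

  prefix-bounds-row : ∀ m → ColumnPrefix U m → ¬ (suc row < m)
  prefix-bounds-row m C lt with ColumnPrefix.prefix-below C row lt
  ... | b , eb , f = stuck (b , eb , λ r er →
         let (r₀ , er₀) = defined-up* 0 row 1 z≤n (r , er) in
         <⇒≤ (<-≤-trans (f r₀ er₀) (col-mono 0 row 1 r₀ r z≤n er₀ er)))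

  prefix-1⇒row-0 : ColumnPrefix U 1 → row ≡ 0
  prefix-1⇒row-0 C with row | moves-down
  ... | zero | _ = refl
  ... | suc a′ | dn with dn 0 (s≤s z≤n)
  ... | b , eb , f with ColumnPrefix.next-above C b eb
  ... | r , er , rb = ⊥-elim (<⇒≱ rb (f r er))

  prefix-promote : ∀ m′ → ColumnPrefix U (suc (suc m′)) → suc m′ ≤ row → ColumnPrefix U′ (suc m′)
  prefix-promote m′ C le = record { prefix-below = below ; next-above = above }
    where
    right-of-corner : entry′ U′ 0 1 ≡ Maybe.map pred (entry′ U 0 1)
    right-of-corner = elsewhere′ 0 1 (λ _ ()) (<⇒≢ (≤-trans (s≤s z≤n) le))
    below : ∀ k → suc k < suc m′ → ∃ λ b → entry′ U′ (suc k) 0 ≡ just b × (∀ r → entry′ U′ 0 1 ≡ just r → b < r)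
    below k lt with ColumnPrefix.prefix-below C (suc k) (s≤s lt)
    ... | b , eb , f = pred b , trans (column-shift (suc k) (<-≤-trans lt le)) (cong (Maybe.map pred) eb) , g
      where
      g : ∀ r → entry′ U′ 0 1 ≡ just r → pred b < r
      g r′ er′ with map-just⁻ (entry′ U 0 1) r′ (trans (sym right-of-corner) er′)
      ... | r , er , refl = pred-< (positive (suc (suc k)) 0 b eb) (f r er)
    above : ∀ b → entry′ U′ (suc m′) 0 ≡ just b → ∃ λ r → entry′ U′ 0 1 ≡ just r × r < b
    above b′ eb′ with m≤n⇒m<n∨m≡n le
    ... | inj₁ lt with map-just⁻ (entry′ U (suc (suc m′)) 0) b′ (trans (sym (column-shift (suc m′) lt)) eb′)
    ... | b , eb , refl with ColumnPrefix.next-above C b eb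
    ... | r , er , rb = pred r , trans right-of-corner (cong (Maybe.map pred) er) , pred-< (positive 0 1 r er) rb
    above b′ eb′ | inj₂ e
      with map-just⁻ (entry′ U row 1) b′ (trans (sym (row-shift 0)) (subst (λ k → entry′ U′ k 0 ≡ just b′) e eb′))
    ... | b , eb , refl with defined-up* 0 row 1 z≤n (b , eb)
    ... | r , er = pred r , trans right-of-corner (cong (Maybe.map pred) er) ,
                   pred-< (positive 0 1 r er) (col-strict 0 row 1 r b (subst (0 <_) e (s≤s z≤n)) er eb)

  row-decreases : 1 ≤ row → (P′ : Promotion U′) → Promotion.row P′ < row
  row-decreases ge P′ with pred row <? Promotion.row P′
  ... | yes l = ⊥-elim (nd (Promotion.moves-down P′ (pred row) l))
    where
    sp : suc (pred row) ≡ row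
    sp = suc-pred row {{>-nonZero ge}}
    nd : ¬ SlidesDown U′ (pred row)
    nd (b′ , eb′ , f)
      with map-just⁻ (entry′ U row 1) b′ (trans (sym (row-shift 0)) (subst (λ k → entry′ U′ k 0 ≡ just b′) sp eb′))
    ... | b , eb , refl with defined-up (pred row) 1 (b , subst (λ k → entry′ U k 1 ≡ just b) (sym sp) eb)
    ... | r , er =
      <⇒≱ (pred-< (positive (pred row) 1 r er) (colIncreasing (pred row) 1 r b er (subst (λ k → entry′ U k 1 ≡ just b) (sym sp) eb)))
          (f (pred r) (trans (elsewhere′ (pred row) 1 (λ _ ()) (λ q → <-irrefl q (subst (pred row <_) sp (n<1+n (pred row)))))
                             (cong (Maybe.map pred) er)))
  ... | no nl = <-≤-trans (s≤s (≮⇒≥ nl)) (≤-reflexive (suc-pred row {{>-nonZero ge}}))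

  row0-end-promote : ∀ q → 1 ≤ row → RowEndsAt U 0 q → RowEndsAt U′ 0 q
  row0-end-promote zero ge (d , e) with moves-down 0 ge
  ... | b , eb , _ = defined-via {m = entry′ U 1 0} (column-shift 0 ge) (b , eb) ,
                     trans (elsewhere′ 0 1 (λ _ ()) (λ q → <-irrefl q ge)) (cong (Maybe.map pred) e)
  row0-end-promote (suc q) ge (d , e) = defined-via {m = entry′ U 0 (suc q)} (elsewhere′ 0 (suc q) (λ _ ()) (λ e → <-irrefl e ge)) d ,
                                 trans (elsewhere′ 0 (suc (suc q)) (λ _ ()) (λ e → <-irrefl e ge)) (cong (Maybe.map pred) e)

  row-0⇒col : ∀ q → RowEndsAt U 0 q → row ≡ 0 → col ≡ q
  row-0⇒col q (dq , eq) a₀ with <-cmp col q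
  ... | tri≈ _ e _ = e
  ... | tri< l _ _ = ⊥-elim (just≢nothing (trans (sym (proj₂ dq)) (beyond-row-end U 0 col q (subst (λ k → entry′ U k (suc col) ≡ nothing) a₀ after-end) l)))
  ... | tri> _ _ g = ⊥-elim (just≢nothing (trans (sym (proj₂ (subst (λ k → Defined (entry′ U k col)) a₀ end-defined))) (beyond-row-end U 0 q col eq g)))

  corner-removed : entry′ U′ row col ≡ nothing
  corner-removed = trans (row-shift col) (cong (Maybe.map pred) after-end)

  defined-before-promote : ∀ i j → Defined (entry′ U′ i j) → Defined (entry′ U i j)
  defined-before-promote i j d with <-cmp i row
  ... | tri≈ _ refl _ = defined-left U i j (defined-back {m = entry′ U i (suc j)} (row-shift j) d)
  ... | tri> nl n _ = defined-back {m = entry′ U i j} (elsewhere′ i j (λ l → ⊥-elim (nl l)) n) d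
  ... | tri< l n _ with j
  ... | zero = defined-up i 0 (defined-back {m = entry′ U (suc i) 0} (column-shift i l) d)
  ... | suc j′ = defined-back {m = entry′ U i (suc j′)} (elsewhere′ i (suc j′) (λ _ ()) n) d

  defined-after-promote : ∀ i j → Defined (entry′ U i j) → (i ≡ row × j ≡ col) ⊎ Defined (entry′ U′ i j)
  defined-after-promote i j d with <-cmp i row
  ... | tri> nl n _ = inj₂ (defined-via {m = entry′ U i j} (elsewhere′ i j (λ l → ⊥-elim (nl l)) n) d)
  ... | tri< l n _ with j
  ... | zero = inj₂ (defined-via {m = entry′ U (suc i) 0} (column-shift i l) (let (b , eb , _) = moves-down i l in b , eb))
  ... | suc j′ = inj₂ (defined-via {m = entry′ U i (suc j′)} (elsewhere′ i (suc j′) (λ _ ()) n) d)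
  defined-after-promote i j d | tri≈ _ refl _ with <-cmp j col
  ... | tri≈ _ e _ = inj₁ (refl , e)
  ... | tri< l _ _ = inj₂ (defined-via {m = entry′ U i (suc j)} (row-shift j) (defined-left* U i (suc j) col l end-defined))
  ... | tri> _ _ g = ⊥-elim (just≢nothing (trans (sym (proj₂ (defined-left* U i (suc col) j g d))) after-end))

nth∈ : ∀ (r : List ℕ) j x → nth r j ≡ just x → x ∈ r
nth∈ (y ∷ r) zero    x refl = here refl
nth∈ (y ∷ r) (suc j) x e    = there (nth∈ r j x e)

∈⇒nth : ∀ (r : List ℕ) x → x ∈ r → ∃ λ j → nth r j ≡ just x
∈⇒nth (y ∷ r) x (here refl) = 0 , refl
∈⇒nth (y ∷ r) x (there m) with ∈⇒nth r x m
... | j , e = suc j , e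

entry′∈concat : ∀ T i j x → entry′ T i j ≡ just x → x ∈ concat T
entry′∈concat (r ∷ T) zero    j x e = ∈-++⁺ˡ (nth∈ r j x e)
entry′∈concat (r ∷ T) (suc i) j x e = ∈-++⁺ʳ r (entry′∈concat T i j x e)

∈concat⇒entry′ : ∀ T x → x ∈ concat T → ∃₂ λ i j → entry′ T i j ≡ just x
∈concat⇒entry′ (r ∷ T) x m with ∈-++⁻ r m
... | inj₁ m₁ = let (j , e) = ∈⇒nth r x m₁ in 0 , j , e
... | inj₂ m₂ = let (i , j , e) = ∈concat⇒entry′ T x m₂ in suc i , j , e

size≡length-concat : ∀ T → size T ≡ length (concat T)
size≡length-concat []      = refl
size≡length-concat (r ∷ T) = trans (cong (length r +_) (size≡length-concat T)) (sym (length-++ r))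

unique-++⁻ : ∀ (xs : List ℕ) {ys} → Unique (xs ++ ys) → Unique xs × Unique ys × (∀ v → v ∈ xs → v ∈ ys → ⊥)
unique-++⁻ []       u        = [] , u , λ v ()
unique-++⁻ (x ∷ xs) (px ∷ u) with unique-++⁻ xs u | All.++⁻ xs px
... | u₁ , u₂ , disjoint | px₁ , px₂ =
  px₁ ∷ u₁ , u₂ , λ { v (here refl) m → All.lookup px₂ m refl ; v (there m₁) m → disjoint v m₁ m }

unique-nth : ∀ (r : List ℕ) j j′ x → Unique r → nth r j ≡ just x → nth r j′ ≡ just x → j ≡ j′
unique-nth (y ∷ r) zero    zero     x _        e₁   e₂   = refl
unique-nth (y ∷ r) zero    (suc j′) x (py ∷ u) refl e₂   = ⊥-elim (All.lookup py (nth∈ r j′ y e₂) refl)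
unique-nth (y ∷ r) (suc j) zero     x (py ∷ u) e₁   refl = ⊥-elim (All.lookup py (nth∈ r j y e₁) refl)
unique-nth (y ∷ r) (suc j) (suc j′) x (py ∷ u) e₁   e₂   = cong suc (unique-nth r j j′ x u e₁ e₂)

unique-entry′ : ∀ T i j i′ j′ x → Unique (concat T) → entry′ T i j ≡ just x → entry′ T i′ j′ ≡ just x →
                i ≡ i′ × j ≡ j′
unique-entry′ (r ∷ T) i j i′ j′ x u e₁ e₂ with unique-++⁻ r u | i | i′
... | u₁ , u₂ , disjoint | zero  | zero   = refl , unique-nth r j j′ x u₁ e₁ e₂
... | u₁ , u₂ , disjoint | zero  | suc i₂ = ⊥-elim (disjoint x (nth∈ r j x e₁) (entry′∈concat T i₂ j′ x e₂))
... | u₁ , u₂ , disjoint | suc i₁ | zero  = ⊥-elim (disjoint x (nth∈ r j′ x e₂) (entry′∈concat T i₁ j x e₁))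
... | u₁ , u₂ , disjoint | suc i₁ | suc i₂ =
  let (p , q) = unique-entry′ T i₁ j i₂ j′ x u₂ e₁ e₂ in cong suc p , q

countLeq-mono : ∀ y x L → y ≤ x → countLeq y L ≤ countLeq x L
countLeq-mono y x []      y≤x = z≤n
countLeq-mono y x (z ∷ L) y≤x with z ≤ᵇ y in e₁ | z ≤ᵇ x in e₂
... | true  | true  = s≤s (countLeq-mono y x L y≤x)
... | true  | false = ⊥-elim (subst Bool.T e₂ (≤⇒≤ᵇ (≤-trans (≤ᵇ⇒≤ z y (subst Bool.T (sym e₁) tt)) y≤x)))
... | false | true  = m≤n⇒m≤1+n (countLeq-mono y x L y≤x)
... | false | false = countLeq-mono y x L y≤x

countLeq-strict : ∀ y x L → y < x → x ∈ L → countLeq y L < countLeq x L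
countLeq-strict y x (z ∷ L) y<x (here refl) with z ≤ᵇ y in e₁ | z ≤ᵇ z in e₂
... | true  | _     = ⊥-elim (<⇒≱ y<x (≤ᵇ⇒≤ z y (subst Bool.T (sym e₁) tt)))
... | false | true  = s≤s (countLeq-mono y z L (<⇒≤ y<x))
... | false | false = ⊥-elim (subst Bool.T e₂ (≤⇒≤ᵇ (≤-refl {z})))
countLeq-strict y x (z ∷ L) y<x (there m) with z ≤ᵇ y in e₁ | z ≤ᵇ x in e₂
... | true  | true  = s≤s (countLeq-strict y x L y<x m)
... | true  | false = ⊥-elim (subst Bool.T e₂ (≤⇒≤ᵇ (≤-trans (≤ᵇ⇒≤ z y (subst Bool.T (sym e₁) tt)) (<⇒≤ y<x))))
... | false | true  = m≤n⇒m≤1+n (countLeq-strict y x L y<x m)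
... | false | false = countLeq-strict y x L y<x m

countLeq-positive : ∀ x L → x ∈ L → 1 ≤ countLeq x L
countLeq-positive x (z ∷ L) m with z ≤ᵇ x in e
... | true = s≤s z≤n
... | false with m
... | here refl = ⊥-elim (subst Bool.T e (≤⇒≤ᵇ (≤-refl {z})))
... | there m′ = countLeq-positive x L m′

-- For i = 0 the witness is x − 1, which lies in the first row by the Richardson
-- condition; for i > 0 it comes from crop T, whose standardization preserves the
-- relative order of entries.
richardson⇒interlacing : ∀ T → Richardson T → (∀ i j x → entry′ T i j ≡ just x → 1 ≤ x) → Interlacing T
richardson⇒interlacing [] rich-[] positive i j x ()
richardson⇒interlacing (r ∷ rs) (rich-∷ second-row _) positive zero j x ex i₂ j₂ z _ _ z<x =
  let (c , ec) = second-row j x (trans (entry≡entry′ (r ∷ rs) 1 j) ex) in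
  c , x ∸ 1 , trans (sym (entry≡entry′ (r ∷ rs) 0 c)) ec , ∸-monoˡ-≤ 1 z<x , ∸1< x (positive 1 j x ex)
  where
  ∸1< : ∀ x → 1 ≤ x → x ∸ 1 < x
  ∸1< (suc x) _ = n<1+n x
richardson⇒interlacing (r ∷ rs) (rich-∷ _ cropped) positive (suc i) j x ex (suc i₂) j₂ z (s≤s le) ez z<x =
  let (j′ , w′ , ew′ , z≤w′ , w′<x) = IH i j (rank x) (rank-entry (suc i) j x ex) i₂ j₂ (rank z) le
                                         (rank-entry i₂ j₂ z ez) (countLeq-strict z x L z<x (∈L (suc i) j x ex))
      (w , ew , ranked) = map-just⁻ (entry′ rs i j′) w′ (trans (sym (entry′-map rank rs i j′)) ew′)
  in j′ , w , ew ,
     ≮⇒≥ (λ w<z → <⇒≱ (countLeq-strict w z L w<z (∈L i₂ j₂ z ez)) (subst (rank z ≤_) (sym ranked) z≤w′)) ,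
     ≰⇒> (λ x≤w → <⇒≱ (subst (_< rank x) (sym ranked) w′<x) (countLeq-mono x w L x≤w))
  where
  L : List ℕ
  L = concat rs
  rank : ℕ → ℕ
  rank y = countLeq y L
  ∈L : ∀ i j y → entry′ rs i j ≡ just y → y ∈ L
  ∈L = entry′∈concat rs
  rank-entry : ∀ i j y → entry′ rs i j ≡ just y → entry′ (standardize rs) i j ≡ just (rank y)
  rank-entry i j y e = trans (entry′-map rank rs i j) (cong (Maybe.map rank) e)
  IH : Interlacing (standardize rs)
  IH = richardson⇒interlacing (standardize rs) cropped λ i j y e →
         let (y₀ , e₀ , q) = map-just⁻ (entry′ rs i j) y (trans (sym (entry′-map rank rs i j)) e) in
         subst (1 ≤_) q (countLeq-positive y₀ L (∈L i j y₀ e₀))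

rowsNonEmpty-from-nth : ∀ T → (∀ i r → nth T i ≡ just r → 0 < length r) → RowsNonEmpty T
rowsNonEmpty-from-nth []      f = tt
rowsNonEmpty-from-nth (r ∷ T) f = f 0 r refl , rowsNonEmpty-from-nth T (λ i → f (suc i))

module StandardTableau {n : ℕ} {T : Tableau} (S : IsSYT n T) where
  open IsSYT S

  entry-range : ∀ i j x → entry′ T i j ≡ just x → 1 ≤ x × x ≤ n
  entry-range i j x e with ∈-map⁻ suc (∈-resp-↭ entriesPerm (entry′∈concat T i j x e))
  ... | y , y∈ , refl = s≤s z≤n , ∈-upTo⁻ y∈

  entry-exists : ∀ x → 1 ≤ x → x ≤ n → ∃₂ λ i j → entry′ T i j ≡ just x
  entry-exists (suc y) _ le = ∈concat⇒entry′ T (suc y) (∈-resp-↭ (↭-sym entriesPerm) (∈-map⁺ suc (∈-upTo⁺ le)))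

  size≡n : size T ≡ n
  size≡n = begin
    size T                   ≡⟨ size≡length-concat T ⟩
    length (concat T)        ≡⟨ ↭-length entriesPerm ⟩
    length (map suc (upTo n)) ≡⟨ length-map suc (upTo n) ⟩
    length (upTo n)          ≡⟨ length-applyUpTo (λ x → x) n ⟩
    n                        ∎
    where open ≡-Reasoning

  defined-up : ∀ i j → Defined (entry′ T (suc i) j) → Defined (entry′ T i j)
  defined-up i j (x , e) with entry′⇒row T (suc i) j x e
  ... | r′ , nr′ , nj with nth-defined-pred T i (r′ , nr′)
  ... | r , nr = subst Defined (sym (entry′-row T i r j nr))
                   (<length⇒nth-defined r j (<-≤-trans (nth-defined⇒<length r′ j (x , nj)) (shapeDecr i r r′ nr nr′)))

  admissible : Richardson T → Admissible T
  admissible R = record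
    { rowsNonEmpty = rowsNonEmpty-from-nth T rowsNonEmpty
    ; defined-up = defined-up
    ; rowIncreasing = λ i j x y e₁ e₂ →
        rowIncr i j x y (trans (entry≡entry′ T i j) e₁) (trans (entry≡entry′ T i (suc j)) e₂)
    ; colIncreasing = λ i j x y e₁ e₂ →
        let (x′ , ex′ , x′<y) = colIncr i j y (trans (entry≡entry′ T (suc i) j) e₂) in
        subst (_< y) (just-injective (trans (sym (trans (sym (entry≡entry′ T i j)) ex′)) e₁)) x′<y
    ; positive = λ i j x e → proj₁ (entry-range i j x e)
    ; injective = λ i j i′ j′ x → unique-entry′ T i j i′ j′ x distinct
    ; interlacing = richardson⇒interlacing T R (λ i j x e → proj₁ (entry-range i j x e))
    }
    where
    distinct : Unique (concat T)
    distinct = Unique-resp-↭ (↭⇒↭ₛ (↭-sym entriesPerm)) (Unique.map⁺ suc-injective (Unique.upTo⁺ n))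

module FirstColumn {n : ℕ} {T : Tableau} (S : IsSYT n T) (A : Admissible T) (1≤n : 1 ≤ n) (m : ℕ)
                   (has-m : FirstColumnHas T m) (lacks-m+1 : ¬ FirstColumnHas T (suc m)) where
  open StandardTableau S using (entry-range; entry-exists)
  open Admissible A
  open AdmissibleProperties A

  column-lower-bound : ∀ i v → entry′ T i 0 ≡ just v → suc i ≤ v
  column-lower-bound zero    v e = positive 0 0 v e
  column-lower-bound (suc i) v e with defined-up i 0 (v , e)
  ... | w , ew = <-≤-trans (s≤s (column-lower-bound i w ew)) (colIncreasing i 0 w v ew e)

  in-column : ∀ k → 1 ≤ k → k ≤ m → ∃ λ i → entry′ T i 0 ≡ just k
  in-column k 1≤k k≤m with has-m k 1≤k k≤m
  ... | i , e = i , trans (sym (entry≡entry′ T i 0)) e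

  first-column-upto : ∀ k → k < m → ∀ k′ → k′ ≤ k → entry′ T k′ 0 ≡ just (suc k′)
  first-column-upto k k<m k′ k′≤k with in-column (suc k′) (s≤s z≤n) (≤-trans (s≤s k′≤k) k<m)
  ... | i , ei with <-cmp i k′
  ... | tri≈ _ refl _ = ei
  ... | tri> _ _ k′<i = ⊥-elim (<⇒≱ k′<i (≤-pred (column-lower-bound i (suc k′) ei)))
  ... | tri< i<k′ _ _ with k
  ... | zero   = ⊥-elim (<⇒≱ i<k′ (≤-trans k′≤k z≤n))
  ... | suc k₀ = ⊥-elim (<-irrefl (suc-injective (just-injective
                   (trans (sym (first-column-upto k₀ (<⇒≤ k<m) i (≤-pred (≤-trans i<k′ k′≤k)))) ei))) i<k′)

  first-column : ∀ k → k < m → entry′ T k 0 ≡ just (suc k)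
  first-column k k<m = first-column-upto k k<m k ≤-refl

  corner≡1 : entry′ T 0 0 ≡ just 1
  corner≡1 with entry-exists 1 (s≤s z≤n) 1≤n
  ... | i , j , e with defined-up* 0 i j z≤n (1 , e)
  ... | w , ew with defined-left* T 0 0 j z≤n (w , ew)
  ... | v , ev = trans ev (cong just (≤-antisym (mono 0 0 i j v 1 z≤n z≤n ev e) (positive 0 0 v ev)))

  1≤m : 1 ≤ m
  1≤m = positive-bound m lacks-m+1
    where
    positive-bound : ∀ k → ¬ FirstColumnHas T (suc k) → 1 ≤ k
    positive-bound (suc _) _     = s≤s z≤n
    positive-bound zero    lacks = ⊥-elim (lacks λ { (suc zero) _ _ → 0 , trans (entry≡entry′ T 0 0) corner≡1
                                                  ; (suc (suc k)) _ (s≤s ()) })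

  m≤n : m ≤ n
  m≤n = bound m 1≤m first-column
    where
    bound : ∀ k → 1 ≤ k → (∀ k′ → k′ < k → entry′ T k′ 0 ≡ just (suc k′)) → k ≤ n
    bound (suc k₀) _ column = proj₂ (entry-range k₀ 0 (suc k₀) (column k₀ ≤-refl))

  m+1∉first-column : ∀ i → entry′ T i 0 ≢ just (suc m)
  m+1∉first-column i e = lacks-m+1 has-m+1
    where
    has-m+1 : FirstColumnHas T (suc m)
    has-m+1 k 1≤k k≤m+1 with m≤n⇒m<n∨m≡n k≤m+1
    ... | inj₁ k<m+1 = has-m k 1≤k (≤-pred k<m+1)
    ... | inj₂ refl  = i , trans (entry≡entry′ T i 0) e

  m<right-of-corner : ∀ r → entry′ T 0 1 ≡ just r → m < r
  m<right-of-corner r e = ≰⇒> (not-≤ r e (off-corner⇒≥2 0 1 r e (inj₂ (λ ()))))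
    where
    not-≤ : ∀ r → entry′ T 0 1 ≡ just r → 2 ≤ r → ¬ r ≤ m
    not-≤ (suc r₀) e (s≤s _) r≤m with injective 0 1 r₀ 0 (suc r₀) e (first-column r₀ r≤m)
    ... | _ , ()

  -- The entry m + 1 lies outside the first column, hence weakly below-right of
  -- (0 , 1); so T(0 , 1) ≤ m + 1 < T(m , 0).
  above-right-of-corner : ∀ b → entry′ T m 0 ≡ just b → ∃ λ r → entry′ T 0 1 ≡ just r × r < b
  above-right-of-corner = above m 1≤m first-column m+1∉first-column
    where
    above : ∀ k → 1 ≤ k → (∀ k′ → k′ < k → entry′ T k′ 0 ≡ just (suc k′)) → (∀ i → entry′ T i 0 ≢ just (suc k)) →
            ∀ b → entry′ T k 0 ≡ just b → ∃ λ r → entry′ T 0 1 ≡ just r × r < b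
    above (suc k) _ column k+2∉column b eb = via (entry-exists (suc (suc k)) (s≤s z≤n) (<⇒≤ (<-≤-trans k+2<b b≤n)))
      where
      k+2<b : suc (suc k) < b
      k+2<b = ≤∧≢⇒< (colIncreasing k 0 (suc k) b (column k ≤-refl) eb) (λ q → k+2∉column (suc k) (trans eb (cong just (sym q))))
      b≤n : b ≤ n
      b≤n = proj₂ (entry-range (suc k) 0 b eb)
      via : (∃₂ λ i j → entry′ T i j ≡ just (suc (suc k))) → ∃ λ r → entry′ T 0 1 ≡ just r × r < b
      via (i , zero , eij) = ⊥-elim (k+2∉column i eij)
      via (i , suc j , eij) with defined-up* 0 i (suc j) z≤n (_ , eij)
      ... | w , ew with defined-left* T 0 1 (suc j) (s≤s z≤n) (w , ew)
      ... | r , er = r , er , ≤-<-trans (mono 0 1 i (suc j) r _ z≤n (s≤s z≤n) er eij) k+2<b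

  columnPrefix : ColumnPrefix T m
  columnPrefix = record
    { prefix-below = λ k k+1<m → suc (suc k) , first-column (suc k) k+1<m , λ r e → ≤-<-trans k+1<m (m<right-of-corner r e)
    ; next-above = above-right-of-corner }

pred∸≡∸suc : ∀ v k → pred v ∸ k ≡ v ∸ suc k
pred∸≡∸suc zero    k = 0∸n≡0 k
pred∸≡∸suc (suc v) k = refl

decide-cell : ∀ i j i₀ j₀ → (i ≡ i₀ × j ≡ j₀) ⊎ (i ≢ i₀ ⊎ j ≢ j₀)
decide-cell i j i₀ j₀ with i ≟ i₀ | j ≟ j₀
... | yes p | yes q = inj₁ (p , q)
... | no p  | _     = inj₂ (inj₁ p)
... | yes _ | no q  = inj₂ (inj₂ q)

defined-setEntry : ∀ C i₀ j₀ v i j → Defined (entry′ C i j) → Defined (entry′ (setEntry C i₀ j₀ v) i j)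
defined-setEntry C i₀ j₀ v i j (x , e) with decide-cell i j i₀ j₀
... | inj₁ (refl , refl) = v , entry′-setEntry-defined C i j v x e
... | inj₂ d            = x , trans (entry′-setEntry-other C i₀ j₀ v i j d) e

absent-setEntry : ∀ C i₀ j₀ v i j → entry′ C i j ≡ nothing → entry′ (setEntry C i₀ j₀ v) i j ≡ nothing
absent-setEntry C i₀ j₀ v i j e with decide-cell i j i₀ j₀
... | inj₁ (refl , refl) = trans (entry′-setEntry-same C i j v) (cong (Maybe.map (λ _ → v)) e)
... | inj₂ d            = trans (entry′-setEntry-other C i₀ j₀ v i j d) e

place-absent : ∀ cs v C i j → entry′ C i j ≡ nothing → entry′ (place cs v C) i j ≡ nothing
place-absent []               v C i j e = e
place-absent ((i₀ , j₀) ∷ cs) v C i j e = place-absent cs (pred v) (setEntry C i₀ j₀ v) i j (absent-setEntry C i₀ j₀ v i j e)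

Unlisted : List (ℕ × ℕ) → ℕ → ℕ → Set
Unlisted cs i j = ∀ k → nth cs k ≢ just (i , j)

place-unlisted : ∀ cs v C i j → Unlisted cs i j → entry′ (place cs v C) i j ≡ entry′ C i j
place-unlisted []               v C i j unlisted = refl
place-unlisted ((i₀ , j₀) ∷ cs) v C i j unlisted with decide-cell i j i₀ j₀
... | inj₁ (refl , refl) = ⊥-elim (unlisted 0 refl)
... | inj₂ d = trans (place-unlisted cs (pred v) (setEntry C i₀ j₀ v) i j (λ k → unlisted (suc k)))
                     (entry′-setEntry-other C i₀ j₀ v i j d)

place-entry⁻ : ∀ cs v C i j x → entry′ (place cs v C) i j ≡ just x →
               (entry′ C i j ≡ just x × Unlisted cs i j) ⊎ (∃ λ k → nth cs k ≡ just (i , j) × x ≡ v ∸ k)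
place-entry⁻ []               v C i j x e = inj₁ (e , λ k ())
place-entry⁻ ((i₀ , j₀) ∷ cs) v C i j x e with place-entry⁻ cs (pred v) (setEntry C i₀ j₀ v) i j x e
... | inj₂ (k , ek , x≡) = inj₂ (suc k , ek , trans x≡ (pred∸≡∸suc v k))
... | inj₁ (e₁ , unlisted) with decide-cell i j i₀ j₀
... | inj₁ (refl , refl) = inj₂ (0 , refl , written (entry′ C i j) (trans (sym (entry′-setEntry-same C i j v)) e₁))
  where
  written : ∀ (m : Maybe ℕ) → Maybe.map (λ _ → v) m ≡ just x → x ≡ v
  written (just _) refl = refl
... | inj₂ d = inj₁ (trans (sym (entry′-setEntry-other C i₀ j₀ v i j d)) e₁ ,
                    λ { zero q → cell-≢ d (just-injective (sym q)) ; (suc k) q → unlisted k q })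
  where
  cell-≢ : i ≢ i₀ ⊎ j ≢ j₀ → (i , j) ≢ (i₀ , j₀)
  cell-≢ (inj₁ n) refl = n refl
  cell-≢ (inj₂ n) refl = n refl

place-last-occurrence : ∀ cs v C k i j → nth cs k ≡ just (i , j) → (∀ k′ → k < k′ → nth cs k′ ≢ just (i , j)) →
                        Defined (entry′ C i j) → entry′ (place cs v C) i j ≡ just (v ∸ k)
place-last-occurrence ((i₀ , j₀) ∷ cs) v C zero i j refl later (x , e) =
  trans (place-unlisted cs (pred v) (setEntry C i j v) i j (λ k q → later (suc k) (s≤s z≤n) q)) (entry′-setEntry-defined C i j v x e)
place-last-occurrence ((i₀ , j₀) ∷ cs) v C (suc k) i j ek later d =
  trans (place-last-occurrence cs (pred v) (setEntry C i₀ j₀ v) k i j ek (λ k′ lt q → later (suc k′) (s≤s lt) q)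
                               (defined-setEntry C i₀ j₀ v i j d))
        (cong just (pred∸≡∸suc v k))

lastElem-nth : ∀ (r : List ℕ) q x → nth r q ≡ just x → nth r (suc q) ≡ nothing → lastElem r ≡ just x
lastElem-nth (y ∷ [])    zero    x e  _  = e
lastElem-nth (y ∷ z ∷ r) zero    x e  ()
lastElem-nth (y ∷ [])    (suc q) x () _
lastElem-nth (y ∷ z ∷ r) (suc q) x e  e′ = lastElem-nth (z ∷ r) q x e e′

promotion : ∀ T → Admissible T → Defined (entry′ T 0 0) → Promotion T
promotion T A (x , e) = Promote.promotion T A x e

admissible-promote : ∀ {T} → Admissible T → Promotion T → Admissible (proj₁ (promote T))
admissible-promote A P = PromotionPreserves.admissible′ A P

stage : ℕ → Tableau → Tableau
stage zero    T = T
stage (suc k) T = stage k (proj₁ (promote T))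

stage-suc : ∀ k T → stage (suc k) T ≡ proj₁ (promote (stage k T))
stage-suc zero    T = refl
stage-suc (suc k) T = stage-suc k (proj₁ (promote T))

-- The cell in which the (k + 1)-st evacuation slide terminates.
slideEnd : ℕ → Tableau → ℕ × ℕ
slideEnd k T = proj₂ (promote (stage k T))

nth-evacCornersAux : ∀ k N T → k < N → nth (evacCornersAux N T) k ≡ just (slideEnd k T)
nth-evacCornersAux zero    (suc N) T lt       = refl
nth-evacCornersAux (suc k) (suc N) T (s≤s lt) = nth-evacCornersAux k N (proj₁ (promote T)) lt

nth-evacCornersAux⁻ : ∀ k N T c → nth (evacCornersAux N T) k ≡ just c → k < N
nth-evacCornersAux⁻ zero    (suc N) T c e = s≤s z≤n
nth-evacCornersAux⁻ (suc k) (suc N) T c e = s≤s (nth-evacCornersAux⁻ k N (proj₁ (promote T)) c e)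

corner-defined : ∀ U → RowsNonEmpty U → 1 ≤ size U → Defined (entry′ U 0 0)
corner-defined ([] ∷ U)      (() , _) _
corner-defined ((x ∷ r) ∷ U) _        _ = x , refl

admissible-stage : ∀ k U → Admissible U → k ≤ size U → Admissible (stage k U) × k + size (stage k U) ≡ size U
admissible-stage zero    U A le = A , refl
admissible-stage (suc k) U A le =
  let P = promotion U A (corner-defined U (Admissible.rowsNonEmpty A) (≤-trans (s≤s z≤n) le))
      shrinks = Promotion.size-promote P
      (Aₖ , sizeₖ) = admissible-stage k (proj₁ (promote U)) (admissible-promote A P)
                       (≤-pred (≤-trans le (≤-reflexive (sym shrinks))))
  in Aₖ , trans (cong suc sizeₖ) shrinks

module Stages (T : Tableau) (A : Admissible T) (n : ℕ) (size≡n : size T ≡ n) where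

  admissible-at : ∀ k → k ≤ n → Admissible (stage k T)
  admissible-at k le = proj₁ (admissible-stage k T A (subst (k ≤_) (sym size≡n) le))

  size-at : ∀ k → k ≤ n → k + size (stage k T) ≡ n
  size-at k le = trans (proj₂ (admissible-stage k T A (subst (k ≤_) (sym size≡n) le))) size≡n

  corner-defined-at : ∀ k → k < n → Defined (entry′ (stage k T) 0 0)
  corner-defined-at k lt = corner-defined (stage k T) (Admissible.rowsNonEmpty (admissible-at k (<⇒≤ lt)))
    (≰⇒> λ size≤0 → <⇒≱ lt (begin
      n                    ≡⟨ sym (size-at k (<⇒≤ lt)) ⟩
      k + size (stage k T) ≤⟨ +-monoʳ-≤ k size≤0 ⟩
      k + 0                ≡⟨ +-identityʳ k ⟩
      k                    ∎))
    where open ≤-Reasoning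

  promotion-at : ∀ k → k < n → Promotion (stage k T)
  promotion-at k lt = promotion (stage k T) (admissible-at k (<⇒≤ lt)) (corner-defined-at k lt)

  slideEnd≡ : ∀ k (P : Promotion (stage k T)) → slideEnd k T ≡ (Promotion.row P , Promotion.col P)
  slideEnd≡ k P = Promotion.corner P

  promotion-after : ∀ k → suc k < n → Promotion (proj₁ (promote (stage k T)))
  promotion-after k lt =
    promotion _ (admissible-promote (admissible-at k (<⇒≤ (<-trans (n<1+n k) lt))) (promotion-at k (<-trans (n<1+n k) lt)))
                (subst (λ X → Defined (entry′ X 0 0)) (stage-suc k T) (corner-defined-at (suc k) lt))

  slideEnd-suc≡ : ∀ k (P : Promotion (proj₁ (promote (stage k T)))) → slideEnd (suc k) T ≡ (Promotion.row P , Promotion.col P)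
  slideEnd-suc≡ k P = trans (cong (proj₂ ∘′ promote) (stage-suc k T)) (Promotion.corner P)

  module Step (k : ℕ) (lt : k < n) = PromotionSteps (admissible-at k (<⇒≤ lt)) (promotion-at k lt)

  defined-earlier : ∀ i j d k → k + d ≤ n → Defined (entry′ (stage (k + d) T) i j) → Defined (entry′ (stage k T) i j)
  defined-earlier i j zero    k le dd = subst (λ x → Defined (entry′ (stage x T) i j)) (+-identityʳ k) dd
  defined-earlier i j (suc d) k le dd =
    defined-earlier i j d k (≤-trans (+-monoʳ-≤ k (n≤1+n d)) le)
      (Step.defined-before-promote (k + d) lt i j
        (subst (λ X → Defined (entry′ X i j)) (trans (cong (λ x → stage x T) (+-suc k d)) (stage-suc (k + d) T)) dd))
    where
    lt : k + d < n
    lt = ≤-trans (≤-reflexive (sym (+-suc k d))) le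

  ended-or-defined : ∀ i j → Defined (entry′ T i j) → ∀ k → k ≤ n →
                     (∃ λ k′ → k′ < k × slideEnd k′ T ≡ (i , j)) ⊎ Defined (entry′ (stage k T) i j)
  ended-or-defined i j d zero    le = inj₂ d
  ended-or-defined i j d (suc k) le with ended-or-defined i j d k (<⇒≤ le)
  ... | inj₁ (k′ , lt , e) = inj₁ (k′ , m≤n⇒m≤1+n lt , e)
  ... | inj₂ dₖ with Step.defined-after-promote k le i j dₖ
  ... | inj₁ (refl , refl) = inj₁ (k , ≤-refl , slideEnd≡ k (promotion-at k le))
  ... | inj₂ d′ = inj₂ (subst (λ X → Defined (entry′ X i j)) (sym (stage-suc k T)) d′)

  -- Each slide removes one cell, and after n slides none is left.
  every-cell-is-a-slide-end : ∀ i j → Defined (entry′ T i j) → ∃ λ k → k < n × slideEnd k T ≡ (i , j)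
  every-cell-is-a-slide-end i j d with ended-or-defined i j d n ≤-refl
  ... | inj₁ found = found
  ... | inj₂ dₙ = ⊥-elim (<⇒≱ (≤-trans (s≤s z≤n) (cell-bound (stage n T) i j rowsNonEmpty dₙ)) (≤-reflexive size-n≡0))
    where
    rowsNonEmpty : RowsNonEmpty (stage n T)
    rowsNonEmpty = Admissible.rowsNonEmpty (admissible-at n ≤-refl)
    size-n≡0 : size (stage n T) ≡ 0
    size-n≡0 = +-cancelˡ-≡ n _ _ (trans (size-at n ≤-refl) (sym (+-identityʳ n)))

  slide-end-defined : ∀ k → k < n → Defined (entry′ (stage k T) (proj₁ (slideEnd k T)) (proj₂ (slideEnd k T)))
  slide-end-defined k lt = subst (λ c → Defined (entry′ (stage k T) (proj₁ c) (proj₂ c)))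
                                 (sym (slideEnd≡ k (promotion-at k lt))) (Promotion.end-defined (promotion-at k lt))

  slide-end-removed : ∀ k → k < n → entry′ (stage (suc k) T) (proj₁ (slideEnd k T)) (proj₂ (slideEnd k T)) ≡ nothing
  slide-end-removed k lt =
    subst (λ X → entry′ X (proj₁ (slideEnd k T)) (proj₂ (slideEnd k T)) ≡ nothing) (sym (stage-suc k T))
      (subst (λ c → entry′ (proj₁ (promote (stage k T))) (proj₁ c) (proj₂ c) ≡ nothing)
             (sym (slideEnd≡ k (promotion-at k lt))) (Step.corner-removed k lt))

  slide-ends-distinct : ∀ k k′ → k < k′ → k′ < n → slideEnd k′ T ≢ slideEnd k T
  slide-ends-distinct k k′ k<k′ k′<n same = just≢nothing (trans (sym (proj₂ defined)) (slide-end-removed k (<-trans k<k′ k′<n)))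
    where
    k′≡ : suc k + (k′ ∸ suc k) ≡ k′
    k′≡ = m+[n∸m]≡n k<k′
    defined : Defined (entry′ (stage (suc k) T) (proj₁ (slideEnd k T)) (proj₂ (slideEnd k T)))
    defined = defined-earlier _ _ (k′ ∸ suc k) (suc k) (≤-trans (≤-reflexive k′≡) (<⇒≤ k′<n))
                (subst (λ x → Defined (entry′ (stage x T) (proj₁ (slideEnd k T)) (proj₂ (slideEnd k T)))) (sym k′≡)
                  (subst (λ c → Defined (entry′ (stage k′ T) (proj₁ c) (proj₂ c))) same (slide-end-defined k′ k′<n)))

  nth-evacCorners : ∀ k → k < n → nth (evacCorners T) k ≡ just (slideEnd k T)
  nth-evacCorners k lt = nth-evacCornersAux k (size T) T (subst (k <_) (sym size≡n) lt)

  nth-evacCorners⁻ : ∀ k c → nth (evacCorners T) k ≡ just c → k < n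
  nth-evacCorners⁻ k c e = subst (k <_) size≡n (nth-evacCornersAux⁻ k (size T) T c e)

  termRow-slideEnd : ∀ k → k < n → termRow T (suc k) ≡ just (suc (proj₁ (slideEnd k T)))
  termRow-slideEnd k lt with nth (evacCorners T) k | nth-evacCorners k lt
  ... | .(just (slideEnd k T)) | refl = refl

  evac-entry⁻ : ∀ i j x → entry′ (evac T) i j ≡ just x → ∃ λ k → k < n × slideEnd k T ≡ (i , j) × x ≡ n ∸ k
  evac-entry⁻ i j x e with place-entry⁻ (evacCorners T) (size T) T i j x e
  ... | inj₁ (eT , unlisted) =
    let (k , lt , end) = every-cell-is-a-slide-end i j (x , eT) in
    ⊥-elim (unlisted k (trans (nth-evacCorners k lt) (cong just end)))
  ... | inj₂ (k , ek , x≡) =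
    let lt = nth-evacCorners⁻ k (i , j) ek in
    k , lt , just-injective (trans (sym (nth-evacCorners k lt)) ek) , trans x≡ (cong (_∸ k) size≡n)

  evac-entry : ∀ k → k < n → entry′ (evac T) (proj₁ (slideEnd k T)) (proj₂ (slideEnd k T)) ≡ just (n ∸ k)
  evac-entry k lt =
    trans (place-last-occurrence (evacCorners T) (size T) T k _ _ (nth-evacCorners k lt) later
                                 (defined-earlier _ _ k 0 (<⇒≤ lt) (slide-end-defined k lt)))
          (cong (λ v → just (v ∸ k)) size≡n)
    where
    later : ∀ k′ → k < k′ → nth (evacCorners T) k′ ≢ just (slideEnd k T)
    later k′ k<k′ e = let lt′ = nth-evacCorners⁻ k′ _ e in
      slide-ends-distinct k k′ k<k′ lt′ (just-injective (trans (sym (nth-evacCorners k′ lt′)) e))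

module FirstSlides (T : Tableau) (A : Admissible T) (n : ℕ) (size≡n : size T ≡ n)
                   (m : ℕ) (m≤n : m ≤ n) (prefix : ColumnPrefix T m) (q : ℕ) (ends-at-q : RowEndsAt T 0 q) where
  open Stages T A n size≡n

  slideRow : ℕ → ℕ
  slideRow k = proj₁ (slideEnd k T)

  slideRow≡ : ∀ k lt → slideRow k ≡ Promotion.row (promotion-at k lt)
  slideRow≡ k lt = cong proj₁ (slideEnd≡ k (promotion-at k lt))

  index<n : ∀ k m′ → k + suc m′ ≡ m → k < n
  index<n k m′ e = ≤-trans (≤-trans (s≤s (m≤m+n k m′)) (≤-reflexive (trans (sym (+-suc k m′)) e))) m≤n

  prefix-at : ∀ k m′ → k + suc m′ ≡ m → ColumnPrefix (stage k T) (suc m′)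
  prefix-at zero    m′ e = subst (ColumnPrefix T) (sym e) prefix
  prefix-at (suc k) m′ e =
    subst (λ X → ColumnPrefix X (suc m′)) (sym (stage-suc k T))
      (Step.prefix-promote k lt m′ prefix′ (≤-pred (≮⇒≥ (Step.prefix-bounds-row k lt (suc (suc m′)) prefix′))))
    where
    e′ : k + suc (suc m′) ≡ m
    e′ = trans (+-suc k (suc m′)) e
    lt : k < n
    lt = index<n k (suc m′) e′
    prefix′ : ColumnPrefix (stage k T) (suc (suc m′))
    prefix′ = prefix-at k (suc m′) e′

  prefix≤slideRow : ∀ k m′ (e : k + suc m′ ≡ m) → m′ ≤ slideRow k
  prefix≤slideRow k m′ e = subst (m′ ≤_) (sym (slideRow≡ k (index<n k m′ e)))
                             (≤-pred (≮⇒≥ (Step.prefix-bounds-row k (index<n k m′ e) (suc m′) (prefix-at k m′ e))))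

  1≤slideRow : ∀ k m′ (e : k + suc (suc m′) ≡ m) → 1 ≤ Promotion.row (promotion-at k (index<n k (suc m′) e))
  1≤slideRow k m′ e = ≤-trans (s≤s z≤n) (subst (suc m′ ≤_) (slideRow≡ k (index<n k (suc m′) e)) (prefix≤slideRow k (suc m′) e))

  slideRow-suc< : ∀ k m′ → k + suc (suc m′) ≡ m → slideRow (suc k) < slideRow k
  slideRow-suc< k m′ e =
    subst₂ _<_ (sym (cong proj₁ (slideEnd-suc≡ k P′))) (sym (slideRow≡ k lt))
      (Step.row-decreases k lt (1≤slideRow k m′ e) P′)
    where
    lt : k < n
    lt = index<n k (suc m′) e
    P′ : Promotion (proj₁ (promote (stage k T)))
    P′ = promotion-after k (index<n (suc k) m′ (trans (sym (+-suc k (suc m′))) e))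

  row0-end-at : ∀ k m′ → k + suc m′ ≡ m → RowEndsAt (stage k T) 0 q
  row0-end-at zero    m′ e = ends-at-q
  row0-end-at (suc k) m′ e =
    subst (λ X → RowEndsAt X 0 q) (sym (stage-suc k T))
      (Step.row0-end-promote k lt q (1≤slideRow k m′ e′) (row0-end-at k (suc m′) e′))
    where
    e′ : k + suc (suc m′) ≡ m
    e′ = trans (+-suc k (suc m′)) e
    lt : k < n
    lt = index<n k (suc m′) e′

  last-prefix-row≡0 : ∀ k (e : k + 1 ≡ m) → Promotion.row (promotion-at k (index<n k 0 e)) ≡ 0
  last-prefix-row≡0 k e = Step.prefix-1⇒row-0 k (index<n k 0 e) (prefix-at k 0 e)

  slideEnd-last : ∀ k → k + 1 ≡ m → slideEnd k T ≡ (0 , q)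
  slideEnd-last k e = trans (slideEnd≡ k (promotion-at k lt))
                            (cong₂ _,_ (last-prefix-row≡0 k e) (Step.row-0⇒col k lt q (row0-end-at k 0 e) (last-prefix-row≡0 k e)))
    where lt = index<n k 0 e

  slideRow-decreases : ∀ k → suc (suc k) ≤ m → slideRow (suc k) < slideRow k
  slideRow-decreases k le = slideRow-suc< k (m ∸ suc (suc k)) (trans (+-suc k _) (trans (cong suc (+-suc k _)) (m+[n∸m]≡n le)))

  slideRow-strict : ∀ k₁ k₂ → k₁ < k₂ → k₂ < m → slideRow k₂ < slideRow k₁
  slideRow-strict k₁ (suc k₂) (s≤s le) lt with m≤n⇒m<n∨m≡n le
  ... | inj₂ refl = slideRow-decreases k₁ lt
  ... | inj₁ l    = <-trans (slideRow-decreases k₂ lt) (slideRow-strict k₁ k₂ l (<-trans (n<1+n k₂) lt))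

  slideRow-injective : ∀ k₁ k₂ → k₁ < m → k₂ < m → slideRow k₁ ≡ slideRow k₂ → k₁ ≡ k₂
  slideRow-injective k₁ k₂ l₁ l₂ e with <-cmp k₁ k₂
  ... | tri≈ _ k₁≡k₂ _ = k₁≡k₂
  ... | tri< k₁<k₂ _ _ = ⊥-elim (<-irrefl (sym e) (slideRow-strict k₁ k₂ k₁<k₂ l₂))
  ... | tri> _ _ k₂<k₁ = ⊥-elim (<-irrefl e (slideRow-strict k₂ k₁ k₂<k₁ l₁))

  evac-entry-large⁻ : ∀ i j x → entry′ (evac T) i j ≡ just x → n ∸ m + 1 ≤ x →
                      ∃ λ k → k < m × slideRow k ≡ i × x ≡ n ∸ k
  evac-entry-large⁻ i j x e large with evac-entry⁻ i j x e
  ... | k , _ , end , refl = k , k<m , cong proj₁ end , refl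
    where
    k<m : k < m
    k<m = ≰⇒> λ m≤k → 1+n≰n (begin
      suc (n ∸ m) ≡⟨ +-comm 1 (n ∸ m) ⟩
      n ∸ m + 1   ≤⟨ large ⟩
      n ∸ k       ≤⟨ ∸-monoʳ-≤ n m≤k ⟩
      n ∸ m       ∎)
      where open ≤-Reasoning

  evac-column-strip : NoTwoInSameRow (evac T) (n ∸ m + 1) n
  evac-column-strip a b i j i′ j′ lo≤a _ lo≤b _ ea eb i≡i′
    with evac-entry-large⁻ i j a (trans (sym (entry≡entry′ (evac T) i j)) ea) lo≤a
       | evac-entry-large⁻ i′ j′ b (trans (sym (entry≡entry′ (evac T) i′ j′)) eb) lo≤b
  ... | k₁ , l₁ , r₁ , refl | k₂ , l₂ , r₂ , refl =
    cong (n ∸_) (slideRow-injective k₁ k₂ l₁ l₂ (trans r₁ (trans i≡i′ (sym r₂))))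

  termRows-decrease : ∀ k → 1 ≤ k → k < m → ∃₂ λ r r′ → termRow T k ≡ just r × termRow T (suc k) ≡ just r′ × r′ < r
  termRows-decrease (suc k) _ k+1<m =
    _ , _ , termRow-slideEnd k (≤-trans (<⇒≤ k+1<m) m≤n) , termRow-slideEnd (suc k) (≤-trans k+1<m m≤n) ,
    s≤s (slideRow-decreases k k+1<m)

  module LastSlide (k : ℕ) (k+1≡m : k + 1 ≡ m) where
    k<n : k < n
    k<n = ≤-trans (≤-reflexive (trans (+-comm 1 k) k+1≡m)) m≤n

    termRow-m : termRow T m ≡ just 1
    termRow-m = subst (λ x → termRow T x ≡ just 1) (trans (+-comm 1 k) k+1≡m)
                  (trans (termRow-slideEnd k k<n) (cong (just ∘′ suc ∘′ proj₁) (slideEnd-last k k+1≡m)))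

    n∸k≡ : n ∸ k ≡ n ∸ m + 1
    n∸k≡ = begin
      n ∸ k         ≡⟨⟩
      suc n ∸ suc k ≡⟨ cong (suc n ∸_) (trans (+-comm 1 k) k+1≡m) ⟩
      suc n ∸ m     ≡⟨ +-∸-assoc 1 m≤n ⟩
      suc (n ∸ m)   ≡⟨ +-comm 1 (n ∸ m) ⟩
      n ∸ m + 1     ∎
      where open ≡-Reasoning

    evac-first-row-end : entry′ (evac T) 0 q ≡ just (n ∸ m + 1)
    evac-first-row-end =
      trans (subst (λ c → entry′ (evac T) (proj₁ c) (proj₂ c) ≡ just (n ∸ k)) (slideEnd-last k k+1≡m) (evac-entry k k<n))
            (cong just n∸k≡)

    first-row : ∃ λ row → nth (evac T) 0 ≡ just row × nth row q ≡ just (n ∸ m + 1)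
    first-row = entry′⇒row (evac T) 0 q (n ∸ m + 1) evac-first-row-end

    evac-first-row : ∃ λ row → nth (evac T) 0 ≡ just row × lastElem row ≡ just (n ∸ m + 1)
    evac-first-row = proj₁ first-row , proj₁ (proj₂ first-row) ,
      lastElem-nth (proj₁ first-row) q (n ∸ m + 1) (proj₂ (proj₂ first-row))
        (trans (sym (entry′-row (evac T) 0 (proj₁ first-row) (suc q) (proj₁ (proj₂ first-row))))
               (place-absent (evacCorners T) (size T) T 0 (suc q) (proj₂ ends-at-q)))

lemma5p6 : (n : ℕ) (T : Tableau) → 1 ≤ n → IsSYT n T → Richardson T →
  (m : ℕ) → FirstColumnHas T m → ¬ FirstColumnHas T (suc m) →
  ((∀ k → 1 ≤ k → k < m →
      ∃₂ λ r r' → termRow T k ≡ just r × termRow T (suc k) ≡ just r' × r' < r)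
   × termRow T m ≡ just 1)
  × (NoTwoInSameRow (evac T) (n ∸ m + 1) n
     × ∃ λ row → nth (evac T) 0 ≡ just row × lastElem row ≡ just (n ∸ m + 1))
lemma5p6 n T 1≤n S R m has-m lacks-m+1 =
  (termRows-decrease , termRow-m) , evac-column-strip , evac-first-row
  where
  A : Admissible T
  A = StandardTableau.admissible S R
  open FirstColumn S A 1≤n m has-m lacks-m+1 using (corner≡1; 1≤m; m≤n; columnPrefix)
  first-row-end : ∃ λ q → RowEndsAt T 0 q
  first-row-end = row-end T 0 1 corner≡1
  open FirstSlides T A n (StandardTableau.size≡n S) m m≤n columnPrefix (proj₁ first-row-end) (proj₂ first-row-end)
  open LastSlide (pred m) (trans (+-comm (pred m) 1) (suc-pred m {{>-nonZero 1≤m}}))
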